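{- For every integer $n \geq 0$, $j(8n+7) \equiv 0 \pmod{64}$.
   Context: A 01-partition (jagged partition) of a non-negative integer $n$ is a finite sequence $(n_1,\dots,n_m)$ of non-negative integers with $\sum_i n_i = n$, whose last entry satisfies $n_m \geq 1$, and such that $n_j \geq n_{j+1}-1$ and $n_j \geq n_{j+2}$ whenever the indices are in range. The empty sequence is the unique 01-partition of $0$. $j(n)$ denotes the number of 01-partitions of $n$. -}

module Defs where

open import Data.Nat using (ℕ; zero; suc; _+_; _≤_; _≥_)
open import Data.List using (List; []; _∷_)
open import Data.Nat.ListAction using (sum)
open import Data.Product using (Σ; _×_)
open import Data.Unit using (⊤)
open import Relation.Binary.PropositionalEquality using (_≡_)

-- Local conditions of a 01-partition (n_1,...,n_m):
--   n_j ≥ n_{j+1} - 1  (written n_j + 1 ≥ n_{j+1}, equivalent over ℤ)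
--   n_j ≥ n_{j+2}
--   last entry n_m ≥ 1
Jagged : List ℕ → Set
Jagged [] = ⊤
Jagged (a ∷ []) = 1 ≤ a
Jagged (a ∷ b ∷ []) = (suc a ≥ b) × (1 ≤ b)
Jagged (a ∷ b ∷ c ∷ rest) = (suc a ≥ b) × (a ≥ c) × Jagged (b ∷ c ∷ rest)

Is01Partition : ℕ → List ℕ → Set
Is01Partition n xs = Jagged xs × (sum xs ≡ n)

Partition01 : ℕ → Set
Partition01 n = Σ (List ℕ) (Is01Partition n)

-- Bounding the first two parts of a jagged partition by (v, v) and by (v, v + 1) gives generating
-- functions J_v and K_v with (1 - q^(v+1)) J_(v+1) = K_v and (1 - q^(2v+1)) K_v = J_v, so
-- (q;q)_v (q;q²)_v J_v = 1, while J_v agrees with ∑ j(n) q^n up to degree v.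
-- A finite Jacobi triple product, ∑_j (-1)^j q^((j-m)²) [2m choose j]_{q²} = (-1)^m (q;q²)_m²,
-- gives (q²;q²)_m (q;q²)_m² ≡ θ = ∑_{k ∈ ℤ} (-1)^k q^(k²) modulo q^(2m+1), and therefore
-- θ · ∑ j(n) q^n = 1 in every degree.
-- Write θ = 1 - 2ζ with ζ = ∑_k q^((2k+1)²) - ∑_k q^((2k+2)²); then ∑ j(n) q^n = ∑_i 2^i ζ^i.
-- Odd squares are 1 mod 8 and even squares 0 mod 4, so in degree n ≡ 7 (mod 8) the terms ζ^i
-- with i ≤ 3 vanish, while ζ^4 and ζ^5 contribute only through three factors of the first sum,
-- with multiplicities 4 and 10. Hence every term is divisible by 2^6.

module Submission where

open import Data.Nat
  using (ℕ; zero; suc; _≤_; _<_; z≤n; s≤s; _∸_; _≤?_; _≟_; NonZero)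
  renaming (_+_ to _+ℕ_; _*_ to _*ℕ_)
import Data.Nat.Properties as ℕ
open import Data.Nat.Tactic.RingSolver using () renaming (solve-∀ to ℕ-solve-∀)
open import Data.Nat.Induction using (<-rec)
open import Data.Nat.GeneralisedArithmetic using (iterate)
open import Data.Nat.ListAction using (sum)
open import Data.Nat.DivMod using (_%_; [m+kn]%n≡m%n; %-distribˡ-+; m*n%n≡0)
open import Data.Nat.Divisibility using (_∣_; divides)
open import Data.Integer using (ℤ; +_; -_; _-_; _+_; _*_; _^_; 0ℤ; 1ℤ; ∣_∣)
import Data.Integer.Properties as ℤ
open import Data.Integer.Tactic.RingSolver using (solve-∀)
open import Data.List using (List; []; _∷_; _++_)
import Data.List.Properties as List
open import Data.List.Relation.Unary.All using (All; []; _∷_)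
open import Data.List.Relation.Unary.All.Properties using (++⁺)
open import Data.List.Relation.Binary.Permutation.Propositional as ↭ using (_↭_)
import Data.List.Relation.Binary.Permutation.Propositional.Properties as ↭
open import Relation.Binary.Bundles using (Setoid)
import Relation.Binary.Reasoning.Setoid as SetoidReasoning
open import Relation.Binary.PropositionalEquality
  using (_≡_; refl; sym; trans; cong; cong₂; subst; subst₂; module ≡-Reasoning)
open import Relation.Nullary using (¬_; yes; no; Dec)
open import Data.Product using (Σ; _×_; _,_; proj₂)
open import Data.Sum using (_⊎_; inj₁; inj₂)
open import Data.Sum.Function.Propositional using (_⊎-↔_)
open import Data.Product.Function.Dependent.Propositional using (Σ-↔)
open import Data.Fin using (Fin)
import Data.Fin as Fin
import Data.Fin.Properties as Fin
open import Data.Unit using (tt)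
open import Data.Empty using (⊥; ⊥-elim)
open import Function.Bundles using (_↔_; mk↔ₛ′)
open import Function.Properties.Inverse using (↔-trans; ↔-sym; ↔-refl)

open import Defs

∑< : ℕ → (ℕ → ℤ) → ℤ
∑< zero    f = 0ℤ
∑< (suc L) f = f 0 + ∑< L (λ k → f (suc k))

∑<-cong-< : ∀ L {f g : ℕ → ℤ} → (∀ k → k < L → f k ≡ g k) → ∑< L f ≡ ∑< L g
∑<-cong-< zero    h = refl
∑<-cong-< (suc L) h = cong₂ _+_ (h 0 (s≤s z≤n)) (∑<-cong-< L (λ k k<L → h (suc k) (s≤s k<L)))

∑<-cong : ∀ L {f g : ℕ → ℤ} → (∀ k → f k ≡ g k) → ∑< L f ≡ ∑< L g
∑<-cong L h = ∑<-cong-< L (λ k _ → h k)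

∑<-zero : ∀ L (f : ℕ → ℤ) → (∀ k → k < L → f k ≡ 0ℤ) → ∑< L f ≡ 0ℤ
∑<-zero zero    f h = refl
∑<-zero (suc L) f h =
  cong₂ _+_ (h 0 (s≤s z≤n)) (∑<-zero L (λ k → f (suc k)) (λ k k<L → h (suc k) (s≤s k<L)))

∑<-+ : ∀ L (f g : ℕ → ℤ) → ∑< L (λ k → f k + g k) ≡ ∑< L f + ∑< L g
∑<-+ zero    f g = refl
∑<-+ (suc L) f g =
  trans (cong (_+_ (f 0 + g 0)) (∑<-+ L (λ k → f (suc k)) (λ k → g (suc k))))
        (interchange (f 0) (g 0) _ _)
  where
  interchange : ∀ a b c d → (a + b) + (c + d) ≡ (a + c) + (b + d)
  interchange = solve-∀

∑<-*ˡ : ∀ L z (f : ℕ → ℤ) → ∑< L (λ k → z * f k) ≡ z * ∑< L f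
∑<-*ˡ zero    z f = sym (ℤ.*-zeroʳ z)
∑<-*ˡ (suc L) z f =
  trans (cong (_+_ (z * f 0)) (∑<-*ˡ L z (λ k → f (suc k)))) (sym (ℤ.*-distribˡ-+ z (f 0) _))

∑<-neg : ∀ L (f : ℕ → ℤ) → ∑< L (λ k → - f k) ≡ - ∑< L f
∑<-neg L f = begin
  ∑< L (λ k → - f k)       ≡⟨ ∑<-cong L (λ k → sym (ℤ.-1*i≡-i (f k))) ⟩
  ∑< L (λ k → - 1ℤ * f k)  ≡⟨ ∑<-*ˡ L (- 1ℤ) f ⟩
  - 1ℤ * ∑< L f            ≡⟨ ℤ.-1*i≡-i _ ⟩
  - ∑< L f                 ∎
  where open ≡-Reasoning

∑<-snoc : ∀ L (f : ℕ → ℤ) → ∑< (suc L) f ≡ ∑< L f + f L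
∑<-snoc zero    f = trans (ℤ.+-identityʳ (f 0)) (sym (ℤ.+-identityˡ (f 0)))
∑<-snoc (suc L) f =
  trans (cong (_+_ (f 0)) (∑<-snoc L (λ k → f (suc k)))) (sym (ℤ.+-assoc (f 0) _ _))

∑<-split : ∀ L M (f : ℕ → ℤ) → ∑< (L +ℕ M) f ≡ ∑< L f + ∑< M (λ k → f (L +ℕ k))
∑<-split zero    M f = sym (ℤ.+-identityˡ _)
∑<-split (suc L) M f =
  trans (cong (_+_ (f 0)) (∑<-split L M (λ k → f (suc k)))) (sym (ℤ.+-assoc (f 0) _ _))

∑<-extend : ∀ L L′ (f : ℕ → ℤ) → L ≤ L′ → (∀ k → L ≤ k → f k ≡ 0ℤ) → ∑< L f ≡ ∑< L′ f
∑<-extend L L′ f L≤L′ tail = begin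
  ∑< L f                                       ≡⟨ sym (ℤ.+-identityʳ _) ⟩
  ∑< L f + 0ℤ                                  ≡⟨ cong (_+_ (∑< L f)) (sym (∑<-zero (L′ ∸ L) _ (λ k _ → tail (L +ℕ k) (ℕ.m≤m+n L k)))) ⟩
  ∑< L f + ∑< (L′ ∸ L) (λ k → f (L +ℕ k))    ≡⟨ sym (∑<-split L (L′ ∸ L) f) ⟩
  ∑< (L +ℕ (L′ ∸ L)) f                         ≡⟨ cong (λ M → ∑< M f) (ℕ.m+[n∸m]≡n L≤L′) ⟩
  ∑< L′ f                                      ∎
  where open ≡-Reasoning

∑<-swap : ∀ L M (F : ℕ → ℕ → ℤ) → ∑< L (λ i → ∑< M (F i)) ≡ ∑< M (λ j → ∑< L (λ i → F i j))
∑<-swap zero    M F = sym (∑<-zero M _ (λ _ _ → refl))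
∑<-swap (suc L) M F =
  trans (cong (_+_ (∑< M (F 0))) (∑<-swap L M (λ i → F (suc i)))) (sym (∑<-+ M (F 0) _))

∑<-reverse : ∀ L (f : ℕ → ℤ) → ∑< L f ≡ ∑< L (λ k → f (L ∸ suc k))
∑<-reverse zero    f = refl
∑<-reverse (suc L) f = begin
  ∑< (suc L) f                          ≡⟨ ∑<-snoc L f ⟩
  ∑< L f + f L                          ≡⟨ cong (_+ f L) (∑<-reverse L f) ⟩
  ∑< L (λ k → f (L ∸ suc k)) + f L      ≡⟨ ℤ.+-comm _ (f L) ⟩
  f L + ∑< L (λ k → f (L ∸ suc k))      ∎
  where open ≡-Reasoning

∑<-even-odd : ∀ L (f : ℕ → ℤ) → ∑< (L +ℕ L) f ≡ ∑< L (λ i → f (i +ℕ i) + f (suc (i +ℕ i)))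
∑<-even-odd zero    f = refl
∑<-even-odd (suc L) f rewrite ℕ.+-suc L L =
  trans (sym (ℤ.+-assoc (f 0) (f 1) _))
        (cong (_+_ (f 0 + f 1)) (trans (∑<-even-odd L (λ k → f (suc (suc k))))
                                    (∑<-cong L (λ i → cong₂ (λ a b → f a + f b) (step i) (cong suc (step i))))))
  where
  step : ∀ i → suc (suc (i +ℕ i)) ≡ suc i +ℕ suc i
  step i = cong suc (sym (ℕ.+-suc i i))

-- Formal power series over ℤ

Series : Set
Series = ℕ → ℤ

infix 4 _≈_ _≈[_]_

record _≈_ (f g : Series) : Set where
  constructor mk≈
  field coeff : ∀ n → f n ≡ g n
open _≈_ public

-- f ≈[ B ] g  is the congruence  f ≡ g (mod q^B).
record _≈[_]_ (f : Series) (B : ℕ) (g : Series) : Set where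
  constructor mk≈[]
  field coeff< : ∀ n → n < B → f n ≡ g n
open _≈[_]_ public

≈-refl : ∀ {f} → f ≈ f
≈-refl = mk≈ (λ _ → refl)

≈-sym : ∀ {f g} → f ≈ g → g ≈ f
≈-sym p = mk≈ (λ n → sym (coeff p n))

≈-trans : ∀ {f g h} → f ≈ g → g ≈ h → f ≈ h
≈-trans p q = mk≈ (λ n → trans (coeff p n) (coeff q n))

≡⇒≈ : ∀ {f g} → f ≡ g → f ≈ g
≡⇒≈ refl = ≈-refl

≈-setoid : Setoid _ _
≈-setoid = record
  { Carrier = Series ; _≈_ = _≈_
  ; isEquivalence = record { refl = ≈-refl ; sym = ≈-sym ; trans = ≈-trans } }

module ≈-Reasoning = SetoidReasoning ≈-setoid

≈[]-refl : ∀ {B f} → f ≈[ B ] f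
≈[]-refl = mk≈[] (λ _ _ → refl)

≈[]-sym : ∀ {B f g} → f ≈[ B ] g → g ≈[ B ] f
≈[]-sym p = mk≈[] (λ n n<B → sym (coeff< p n n<B))

≈[]-trans : ∀ {B f g h} → f ≈[ B ] g → g ≈[ B ] h → f ≈[ B ] h
≈[]-trans p q = mk≈[] (λ n n<B → trans (coeff< p n n<B) (coeff< q n n<B))

≈⇒≈[] : ∀ {B f g} → f ≈ g → f ≈[ B ] g
≈⇒≈[] p = mk≈[] (λ n _ → coeff p n)

≈[]-weaken : ∀ {B B′ f g} → B′ ≤ B → f ≈[ B ] g → f ≈[ B′ ] g
≈[]-weaken B′≤B p = mk≈[] (λ n n<B′ → coeff< p n (ℕ.<-≤-trans n<B′ B′≤B))

≈[]-setoid : ℕ → Setoid _ _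
≈[]-setoid B = record
  { Carrier = Series ; _≈_ = _≈[ B ]_
  ; isEquivalence = record { refl = ≈[]-refl ; sym = ≈[]-sym ; trans = ≈[]-trans } }

module ≈[]-Reasoning (B : ℕ) = SetoidReasoning (≈[]-setoid B)

0ₛ 1ₛ : Series
0ₛ _       = 0ℤ
1ₛ zero    = 1ℤ
1ₛ (suc _) = 0ℤ

infixl 6 _⊕_
infixr 7 _⊛_
infixr 8 q^_·_ 1-q^_·_ ∏1-q^_·_

_⊕_ : Series → Series → Series
(f ⊕ g) n = f n + g n

_⊛_ : ℤ → Series → Series
(z ⊛ f) n = z * f n

q^_·_ : ℕ → Series → Series
q^ zero  · f         = f
(q^ suc a · f) zero    = 0ℤ
(q^ suc a · f) (suc n) = (q^ a · f) n

1-q^_·_ : ℕ → Series → Series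
(1-q^ a · f) n = f n - (q^ a · f) n

∏1-q^_·_ : List ℕ → Series → Series
∏1-q^ []       · f = f
∏1-q^ (a ∷ as) · f = 1-q^ a · ∏1-q^ as · f

∑ₛ< : ℕ → (ℕ → Series) → Series
∑ₛ< L F n = ∑< L (λ j → F j n)

⊕-cong : ∀ {f f′ g g′} → f ≈ f′ → g ≈ g′ → f ⊕ g ≈ f′ ⊕ g′
⊕-cong p q = mk≈ (λ n → cong₂ _+_ (coeff p n) (coeff q n))

⊕-congˡ : ∀ {f f′} g → f ≈ f′ → f ⊕ g ≈ f′ ⊕ g
⊕-congˡ g p = ⊕-cong p ≈-refl

⊕-congʳ : ∀ f {g g′} → g ≈ g′ → f ⊕ g ≈ f ⊕ g′
⊕-congʳ f p = ⊕-cong (≈-refl {f}) p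

⊛-cong : ∀ z {f f′} → f ≈ f′ → z ⊛ f ≈ z ⊛ f′
⊛-cong z p = mk≈ (λ n → cong (z *_) (coeff p n))

⊕-cong[] : ∀ {B f f′ g g′} → f ≈[ B ] f′ → g ≈[ B ] g′ → f ⊕ g ≈[ B ] f′ ⊕ g′
⊕-cong[] p q = mk≈[] (λ n n<B → cong₂ _+_ (coeff< p n n<B) (coeff< q n n<B))

⊛-cong[] : ∀ {B} z {f f′} → f ≈[ B ] f′ → z ⊛ f ≈[ B ] z ⊛ f′
⊛-cong[] z p = mk≈[] (λ n n<B → cong (z *_) (coeff< p n n<B))

∑ₛ<-cong : ∀ L {F G : ℕ → Series} → (∀ j → F j ≈ G j) → ∑ₛ< L F ≈ ∑ₛ< L G
∑ₛ<-cong L p = mk≈ (λ n → ∑<-cong L (λ j → coeff (p j) n))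

∑ₛ<-cong[] : ∀ {B} L {F G : ℕ → Series} → (∀ j → j < L → F j ≈[ B ] G j) → ∑ₛ< L F ≈[ B ] ∑ₛ< L G
∑ₛ<-cong[] L p = mk≈[] (λ n n<B → ∑<-cong-< L (λ j j<L → coeff< (p j j<L) n n<B))

q^-map : ∀ a (F : ℤ → ℤ) → F 0ℤ ≡ 0ℤ → ∀ f n → (q^ a · (λ m → F (f m))) n ≡ F ((q^ a · f) n)
q^-map zero    F F0 f n       = refl
q^-map (suc a) F F0 f zero    = sym F0
q^-map (suc a) F F0 f (suc n) = q^-map a F F0 f n

q^-map₂ : ∀ a (F : ℤ → ℤ → ℤ) → F 0ℤ 0ℤ ≡ 0ℤ → ∀ f g n →
          (q^ a · (λ m → F (f m) (g m))) n ≡ F ((q^ a · f) n) ((q^ a · g) n)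
q^-map₂ zero    F F0 f g n       = refl
q^-map₂ (suc a) F F0 f g zero    = sym F0
q^-map₂ (suc a) F F0 f g (suc n) = q^-map₂ a F F0 f g n

q^-⊕ : ∀ a f g n → (q^ a · (f ⊕ g)) n ≡ (q^ a · f) n + (q^ a · g) n
q^-⊕ a = q^-map₂ a _+_ refl

q^-⊛ : ∀ a z f n → (q^ a · (z ⊛ f)) n ≡ z * (q^ a · f) n
q^-⊛ a z = q^-map a (z *_) (ℤ.*-zeroʳ z)

q^-+ : ∀ a b f n → (q^ a · q^ b · f) n ≡ (q^ a +ℕ b · f) n
q^-+ zero    b f n       = refl
q^-+ (suc a) b f zero    = refl
q^-+ (suc a) b f (suc n) = q^-+ a b f n

q^-q^ : ∀ a b f → q^ a · q^ b · f ≈ q^ a +ℕ b · f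
q^-q^ a b f = mk≈ (q^-+ a b f)

q^-≡ : ∀ {a b} f → a ≡ b → q^ a · f ≈ q^ b · f
q^-≡ f refl = ≈-refl

q^-q^-≡ : ∀ a b c d f → a +ℕ b ≡ c +ℕ d → q^ a · q^ b · f ≈ q^ c · q^ d · f
q^-q^-≡ a b c d f e = ≈-trans (q^-q^ a b f) (≈-trans (q^-≡ f e) (≈-sym (q^-q^ c d f)))

q^-comm : ∀ a b f n → (q^ a · q^ b · f) n ≡ (q^ b · q^ a · f) n
q^-comm a b f n = trans (q^-+ a b f n) (trans (coeff (q^-≡ f (ℕ.+-comm a b)) n) (sym (q^-+ b a f n)))

q^-below : ∀ a f n → n < a → (q^ a · f) n ≡ 0ℤ
q^-below (suc a) f zero    _         = refl
q^-below (suc a) f (suc n) (s≤s n<a) = q^-below a f n n<a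

q^-at-+ : ∀ a f n → (q^ a · f) (a +ℕ n) ≡ f n
q^-at-+ zero    f n = refl
q^-at-+ (suc a) f n = q^-at-+ a f n

q^-at : ∀ a f n → a ≤ n → (q^ a · f) n ≡ f (n ∸ a)
q^-at a f n a≤n = subst (λ N → (q^ a · f) N ≡ f (N ∸ a)) (ℕ.m+[n∸m]≡n a≤n)
                        (trans (q^-at-+ a f (n ∸ a)) (cong f (sym (ℕ.m+n∸m≡n a (n ∸ a)))))

q^-ext : ∀ a f g n → (∀ m → m +ℕ a ≤ n → f m ≡ g m) → (q^ a · f) n ≡ (q^ a · g) n
q^-ext zero    f g n       h = h n (ℕ.≤-reflexive (ℕ.+-identityʳ n))
q^-ext (suc a) f g zero    h = refl
q^-ext (suc a) f g (suc n) h =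
  q^-ext a f g n (λ m le → h m (subst (_≤ suc n) (sym (ℕ.+-suc m a)) (s≤s le)))

q^-0ₛ : ∀ a n → (q^ a · 0ₛ) n ≡ 0ℤ
q^-0ₛ zero    n       = refl
q^-0ₛ (suc a) zero    = refl
q^-0ₛ (suc a) (suc n) = q^-0ₛ a n

q^-of-0 : ∀ a {f} n → f ≈ 0ₛ → (q^ a · f) n ≡ 0ℤ
q^-of-0 a n p = trans (q^-ext a _ _ n (λ m _ → coeff p m)) (q^-0ₛ a n)

q^-cong : ∀ a {f g} → f ≈ g → q^ a · f ≈ q^ a · g
q^-cong a p = mk≈ (λ n → q^-ext a _ _ n (λ m _ → coeff p m))

q^-cong[] : ∀ a {B f g} → f ≈[ B ] g → q^ a · f ≈[ B ] q^ a · g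
q^-cong[] a {B} p = mk≈[] (λ n n<B → q^-ext a _ _ n
  (λ m le → coeff< p m (ℕ.≤-<-trans (ℕ.≤-trans (ℕ.m≤m+n m a) le) n<B)))

q^-raise[] : ∀ a {B f g} → f ≈[ B ] g → q^ a · f ≈[ a +ℕ B ] q^ a · g
q^-raise[] a {B} p = mk≈[] (λ n n<aB → q^-ext a _ _ n
  (λ m le → coeff< p m (ℕ.+-cancelˡ-< a m B (ℕ.≤-<-trans (subst (_≤ n) (ℕ.+-comm m a) le) n<aB))))

-- Multipliers: the operators  f ↦ h · f  for a fixed series h

record IsMultiplier (O : Series → Series) : Set where
  field
    mul-⊕      : ∀ f g → O (f ⊕ g) ≈ O f ⊕ O g
    mul-⊛      : ∀ z f → O (z ⊛ f) ≈ z ⊛ O f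
    mul-causal : ∀ B {f g} → f ≈[ B ] g → O f ≈[ B ] O g
    mul-q^     : ∀ a f → O (q^ a · f) ≈ q^ a · O f
open IsMultiplier public

module _ {O : Series → Series} (M : IsMultiplier O) where

  mul-cong : ∀ {f g} → f ≈ g → O f ≈ O g
  mul-cong p = mk≈ (λ n → coeff< (mul-causal M (suc n) (≈⇒≈[] p)) n ℕ.≤-refl)

  mul-0ₛ : O 0ₛ ≈ 0ₛ
  mul-0ₛ = mk≈ λ n → begin
    O 0ₛ n          ≡⟨ coeff (mul-cong (mk≈ (λ _ → refl))) n ⟩
    O (0ℤ ⊛ 0ₛ) n   ≡⟨ coeff (mul-⊛ M 0ℤ 0ₛ) n ⟩
    0ℤ * O 0ₛ n     ≡⟨ ℤ.*-zeroˡ (O 0ₛ n) ⟩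
    0ℤ              ∎
    where open ≡-Reasoning

  mul-∑ₛ< : ∀ L F → O (∑ₛ< L F) ≈ ∑ₛ< L (λ j → O (F j))
  mul-∑ₛ< zero    F = mul-0ₛ
  mul-∑ₛ< (suc L) F = ≈-trans (mul-⊕ M (F 0) _) (⊕-congʳ (O (F 0)) (mul-∑ₛ< L (λ j → F (suc j))))

id-isMultiplier : IsMultiplier (λ f → f)
id-isMultiplier = record
  { mul-⊕ = λ _ _ → ≈-refl ; mul-⊛ = λ _ _ → ≈-refl ; mul-causal = λ _ p → p ; mul-q^ = λ _ _ → ≈-refl }

∘-isMultiplier : ∀ {O O′} → IsMultiplier O → IsMultiplier O′ → IsMultiplier (λ f → O (O′ f))
∘-isMultiplier {O} {O′} M M′ = record
  { mul-⊕      = λ f g → ≈-trans (mul-cong M (mul-⊕ M′ f g)) (mul-⊕ M (O′ f) (O′ g))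
  ; mul-⊛      = λ z f → ≈-trans (mul-cong M (mul-⊛ M′ z f)) (mul-⊛ M z (O′ f))
  ; mul-causal = λ B p → mul-causal M B (mul-causal M′ B p)
  ; mul-q^     = λ a f → ≈-trans (mul-cong M (mul-q^ M′ a f)) (mul-q^ M a (O′ f)) }

⊕-isMultiplier : ∀ {O O′} → IsMultiplier O → IsMultiplier O′ → IsMultiplier (λ f → O f ⊕ O′ f)
⊕-isMultiplier {O} {O′} M M′ = record
  { mul-⊕      = λ f g → mk≈ (λ n → trans (cong₂ _+_ (coeff (mul-⊕ M f g) n) (coeff (mul-⊕ M′ f g) n))
                                           (interchange (O f n) (O g n) (O′ f n) (O′ g n)))
  ; mul-⊛      = λ z f → mk≈ (λ n → trans (cong₂ _+_ (coeff (mul-⊛ M z f) n) (coeff (mul-⊛ M′ z f) n))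
                                           (sym (ℤ.*-distribˡ-+ z (O f n) (O′ f n))))
  ; mul-causal = λ B p → ⊕-cong[] (mul-causal M B p) (mul-causal M′ B p)
  ; mul-q^     = λ a f → mk≈ (λ n → trans (cong₂ _+_ (coeff (mul-q^ M a f) n) (coeff (mul-q^ M′ a f) n))
                                           (sym (q^-⊕ a (O f) (O′ f) n))) }
  where
  interchange : ∀ a b c d → (a + b) + (c + d) ≡ (a + c) + (b + d)
  interchange = solve-∀

⊛-isMultiplier : ∀ z {O} → IsMultiplier O → IsMultiplier (λ f → z ⊛ O f)
⊛-isMultiplier z {O} M = record
  { mul-⊕      = λ f g → mk≈ (λ n → trans (cong (z *_) (coeff (mul-⊕ M f g) n)) (ℤ.*-distribˡ-+ z (O f n) (O g n)))
  ; mul-⊛      = λ y f → mk≈ (λ n → trans (cong (z *_) (coeff (mul-⊛ M y f) n)) (swap z y (O f n)))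
  ; mul-causal = λ B p → ⊛-cong[] z (mul-causal M B p)
  ; mul-q^     = λ a f → mk≈ (λ n → trans (cong (z *_) (coeff (mul-q^ M a f) n)) (sym (q^-⊛ a z (O f) n))) }
  where
  swap : ∀ z y x → z * (y * x) ≡ y * (z * x)
  swap = solve-∀

q^-isMultiplier : ∀ a → IsMultiplier (q^ a ·_)
q^-isMultiplier a = record
  { mul-⊕      = λ f g → mk≈ (q^-⊕ a f g)
  ; mul-⊛      = λ z f → mk≈ (q^-⊛ a z f)
  ; mul-causal = λ B p → q^-cong[] a p
  ; mul-q^     = λ b f → mk≈ (q^-comm a b f) }

1-q^-isMultiplier : ∀ a → IsMultiplier (1-q^ a ·_)
1-q^-isMultiplier a = record
  { mul-⊕      = λ f g → mk≈ (λ n → trans (cong (_-_ (f n + g n)) (q^-⊕ a f g n)) (sub-⊕ (f n) (g n) _ _))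
  ; mul-⊛      = λ z f → mk≈ (λ n → trans (cong (_-_ (z * f n)) (q^-⊛ a z f n)) (sub-⊛ z (f n) _))
  ; mul-causal = λ B p → mk≈[] (λ n n<B → cong₂ _-_ (coeff< p n n<B) (coeff< (q^-cong[] a p) n n<B))
  ; mul-q^     = λ b f → mk≈ (λ n → trans (cong (_-_ ((q^ b · f) n)) (q^-comm a b f n))
                                           (sym (q^-map₂ b _-_ refl f (q^ a · f) n))) }
  where
  sub-⊕ : ∀ x y u v → (x + y) - (u + v) ≡ (x - u) + (y - v)
  sub-⊕ = solve-∀
  sub-⊛ : ∀ z x u → z * x - z * u ≡ z * (x - u)
  sub-⊛ = solve-∀

1-q^-cong : ∀ a {f g} → f ≈ g → 1-q^ a · f ≈ 1-q^ a · g
1-q^-cong a = mul-cong (1-q^-isMultiplier a)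

module _ {O : Series → Series} (M : IsMultiplier O) where

  mul-1-q^-comm : ∀ a f → O (1-q^ a · f) ≈ 1-q^ a · O f
  mul-1-q^-comm a f = begin
    O (1-q^ a · f)                   ≈⟨ mul-cong M (1-q^-as-⊕ f) ⟩
    O (f ⊕ - 1ℤ ⊛ q^ a · f)          ≈⟨ mul-⊕ M f _ ⟩
    O f ⊕ O (- 1ℤ ⊛ q^ a · f)        ≈⟨ ⊕-congʳ (O f) (mul-⊛ M (- 1ℤ) _) ⟩
    O f ⊕ - 1ℤ ⊛ O (q^ a · f)        ≈⟨ ⊕-congʳ (O f) (⊛-cong (- 1ℤ) (mul-q^ M a f)) ⟩
    O f ⊕ - 1ℤ ⊛ q^ a · O f          ≈⟨ ≈-sym (1-q^-as-⊕ (O f)) ⟩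
    1-q^ a · O f                     ∎
    where
    open ≈-Reasoning
    1-q^-as-⊕ : ∀ g → 1-q^ a · g ≈ g ⊕ - 1ℤ ⊛ q^ a · g
    1-q^-as-⊕ g = mk≈ (λ n → minus (g n) ((q^ a · g) n))
      where
      minus : ∀ x y → x - y ≡ x + - 1ℤ * y
      minus = solve-∀

  mul-∏1-q^-comm : ∀ as f → O (∏1-q^ as · f) ≈ ∏1-q^ as · O f
  mul-∏1-q^-comm []       f = ≈-refl
  mul-∏1-q^-comm (a ∷ as) f =
    ≈-trans (mul-1-q^-comm a _) (1-q^-cong a (mul-∏1-q^-comm as f))

1-q^-≡ : ∀ {a b} f → a ≡ b → 1-q^ a · f ≈ 1-q^ b · f
1-q^-≡ f refl = ≈-refl

∏1-q^-isMultiplier : ∀ as → IsMultiplier (∏1-q^ as ·_)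
∏1-q^-isMultiplier []       = id-isMultiplier
∏1-q^-isMultiplier (a ∷ as) = ∘-isMultiplier (1-q^-isMultiplier a) (∏1-q^-isMultiplier as)

∏1-q^-++ : ∀ as bs f → ∏1-q^ as ++ bs · f ≡ ∏1-q^ as · ∏1-q^ bs · f
∏1-q^-++ []       bs f = refl
∏1-q^-++ (a ∷ as) bs f = cong (1-q^ a ·_) (∏1-q^-++ as bs f)

∏1-q^-↭ : ∀ {as bs} → as ↭ bs → ∀ f → ∏1-q^ as · f ≈ ∏1-q^ bs · f
∏1-q^-↭ ↭.refl           f = ≈-refl
∏1-q^-↭ (↭.prep a p)     f = 1-q^-cong a (∏1-q^-↭ p f)
∏1-q^-↭ (↭.swap {ys = ys} a b p) f =
  ≈-trans (1-q^-cong a (1-q^-cong b (∏1-q^-↭ p f)))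
          (mul-1-q^-comm (1-q^-isMultiplier a) b (∏1-q^ ys · f))
∏1-q^-↭ (↭.trans p q)    f = ≈-trans (∏1-q^-↭ p f) (∏1-q^-↭ q f)

1-q^-≈[]-id : ∀ a {B} f → B ≤ a → 1-q^ a · f ≈[ B ] f
1-q^-≈[]-id a f B≤a = mk≈[] (λ n n<B →
  trans (cong (_-_ (f n)) (q^-below a f n (ℕ.<-≤-trans n<B B≤a))) (ℤ.+-identityʳ (f n)))

∏1-q^-≈[]-id : ∀ as {B} f → All (B ≤_) as → ∏1-q^ as · f ≈[ B ] f
∏1-q^-≈[]-id []       f []       = ≈[]-refl
∏1-q^-≈[]-id (a ∷ as) f (p ∷ ps) = ≈[]-trans (1-q^-≈[]-id a _ p) (∏1-q^-≈[]-id as f ps)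

-- As a ≥ 1, the n-th coefficient of (1 - q^a) f determines f n from lower coefficients of f.
1-q^-cancel[] : ∀ a {B f g} → 1 ≤ a → 1-q^ a · f ≈[ B ] 1-q^ a · g → f ≈[ B ] g
1-q^-cancel[] a {B} {f} {g} a≥1 p = mk≈[] (<-rec (λ m → m < B → f m ≡ g m) step)
  where
  restore : ∀ x y → (x - y) + y ≡ x
  restore = solve-∀
  step : ∀ m → (∀ {k} → k < m → k < B → f k ≡ g k) → m < B → f m ≡ g m
  step m IH m<B = begin
    f m                                        ≡⟨ sym (restore (f m) _) ⟩
    (1-q^ a · f) m + (q^ a · f) m              ≡⟨ cong₂ _+_ (coeff< p m m<B) (q^-ext a f g m lower) ⟩
    (1-q^ a · g) m + (q^ a · g) m              ≡⟨ restore (g m) _ ⟩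
    g m                                        ∎
    where
    open ≡-Reasoning
    lower : ∀ k → k +ℕ a ≤ m → f k ≡ g k
    lower k le = IH k<m (ℕ.<-trans k<m m<B)
      where k<m = ℕ.<-≤-trans (ℕ.m<m+n k a≥1) le

∏1-q^-cancel[] : ∀ as {B f g} → All (1 ≤_) as → ∏1-q^ as · f ≈[ B ] ∏1-q^ as · g → f ≈[ B ] g
∏1-q^-cancel[] []       []       p = p
∏1-q^-cancel[] (a ∷ as) (q ∷ qs) p = ∏1-q^-cancel[] as qs (1-q^-cancel[] a q p)

∏1-q^-cancel : ∀ as {f g} → All (1 ≤_) as → ∏1-q^ as · f ≈ ∏1-q^ as · g → f ≈ g
∏1-q^-cancel as qs p = mk≈ (λ n → coeff< (∏1-q^-cancel[] as {suc n} qs (≈⇒≈[] p)) n ℕ.≤-refl)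

-- Gaussian binomial coefficients in q²

2*_+1 2*_+2 : ℕ → ℕ
2* m +1 = suc (m +ℕ m)
2* m +2 = suc (suc (m +ℕ m))

upto evens odds : ℕ → List ℕ
upto  zero    = []
upto  (suc r) = suc r ∷ upto r
evens zero    = []
evens (suc r) = 2* r +2 ∷ evens r
odds  zero    = []
odds  (suc r) = 2* r +1 ∷ odds r

upto-positive : ∀ r → All (1 ≤_) (upto r)
upto-positive zero    = []
upto-positive (suc r) = s≤s z≤n ∷ upto-positive r

evens-positive : ∀ r → All (1 ≤_) (evens r)
evens-positive zero    = []
evens-positive (suc r) = s≤s z≤n ∷ evens-positive r

odds-positive : ∀ r → All (1 ≤_) (odds r)
odds-positive zero    = []
odds-positive (suc r) = s≤s z≤n ∷ odds-positive r

∏evens-isMultiplier : ∀ j k → IsMultiplier (λ f → ∏1-q^ evens j · ∏1-q^ evens k · f)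
∏evens-isMultiplier j k = ∘-isMultiplier (∏1-q^-isMultiplier (evens j)) (∏1-q^-isMultiplier (evens k))

∏evens-cancel : ∀ j k {f g} → ∏1-q^ evens j · ∏1-q^ evens k · f ≈ ∏1-q^ evens j · ∏1-q^ evens k · g → f ≈ g
∏evens-cancel j k {f} {g} p =
  ∏1-q^-cancel (evens j ++ evens k) (++⁺ (evens-positive j) (evens-positive k))
    (mk≈ (λ n → trans (cong (λ h → h n) (∏1-q^-++ (evens j) (evens k) f))
               (trans (coeff p n) (sym (cong (λ h → h n) (∏1-q^-++ (evens j) (evens k) g))))))

infix 9 _C[q²]_

_C[q²]_ : ℕ → ℕ → Series
n     C[q²] zero  = 1ₛ
zero  C[q²] suc j = 0ₛ
suc n C[q²] suc j = n C[q²] j ⊕ q^ 2* j +2 · (n C[q²] suc j)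

C[q²]-above : ∀ n j → n < j → n C[q²] j ≈ 0ₛ
C[q²]-above zero    (suc j) _         = ≈-refl
C[q²]-above (suc n) (suc j) (s≤s n<j) = mk≈ (λ x →
  cong₂ _+_ (coeff (C[q²]-above n j n<j) x)
            (q^-of-0 (2* j +2) x (C[q²]-above n (suc j) (ℕ.m<n⇒m<1+n n<j))))

C[q²]-diag : ∀ j → j C[q²] j ≈ 1ₛ
C[q²]-diag zero    = ≈-refl
C[q²]-diag (suc j) = mk≈ (λ x →
  trans (cong₂ _+_ (coeff (C[q²]-diag j) x) (q^-of-0 (2* j +2) x (C[q²]-above j (suc j) ℕ.≤-refl)))
        (ℤ.+-identityʳ (1ₛ x)))

⊕-comm : ∀ f g → f ⊕ g ≈ g ⊕ f
⊕-comm f g = mk≈ (λ n → ℤ.+-comm (f n) (g n))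

1-q^-+ : ∀ a b f → 1-q^ a · f ⊕ q^ a · 1-q^ b · f ≈ 1-q^ a +ℕ b · f
1-q^-+ a b f = mk≈ (λ n → trans
  (cong (_+_ ((1-q^ a · f) n)) (trans (q^-map₂ a _-_ refl f (q^ b · f) n) (cong (_-_ ((q^ a · f) n)) (q^-+ a b f n))))
  (telescope (f n) _ _))
  where
  telescope : ∀ x y z → (x - y) + (y - z) ≡ x - z
  telescope = solve-∀

C[q²]-factorial : ∀ j k → ∏1-q^ evens j · ∏1-q^ evens k · ((j +ℕ k) C[q²] j) ≈ ∏1-q^ evens (j +ℕ k) · 1ₛ
C[q²]-factorial zero    k = ≈-refl
C[q²]-factorial (suc j) zero rewrite ℕ.+-identityʳ j = mul-cong (∏1-q^-isMultiplier (evens (suc j))) (C[q²]-diag (suc j))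
C[q²]-factorial (suc j) (suc k) rewrite ℕ.+-suc j k = begin
  P (A ⊕ q^ 2* j +2 · C)                               ≈⟨ mul-⊕ M A _ ⟩
  P A ⊕ P (q^ 2* j +2 · C)                             ≈⟨ ⊕-cong (1-q^-cong (2* j +2) IH₁) (mul-q^ M (2* j +2) C) ⟩
  1-q^ 2* j +2 · E ⊕ q^ 2* j +2 · P C                  ≈⟨ ⊕-congʳ (1-q^ 2* j +2 · E) (q^-cong (2* j +2) (begin
    P C                                                  ≈⟨ mul-1-q^-comm (∏1-q^-isMultiplier (evens (suc j))) (2* k +2) _ ⟩
    1-q^ 2* k +2 · ∏1-q^ evens (suc j) · ∏1-q^ evens k · C ≈⟨ 1-q^-cong (2* k +2) (C[q²]-factorial (suc j) k) ⟩
    1-q^ 2* k +2 · E                                     ∎)) ⟩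
  1-q^ 2* j +2 · E ⊕ q^ 2* j +2 · 1-q^ 2* k +2 · E     ≈⟨ 1-q^-+ (2* j +2) (2* k +2) E ⟩
  1-q^ 2* j +2 +ℕ 2* k +2 · E                          ≈⟨ 1-q^-≡ E (exponent j k) ⟩
  ∏1-q^ evens (suc (suc (j +ℕ k))) · 1ₛ                ∎
  where
  open ≈-Reasoning
  P : Series → Series
  P f = ∏1-q^ evens (suc j) · ∏1-q^ evens (suc k) · f
  M = ∏evens-isMultiplier (suc j) (suc k)
  A = suc (j +ℕ k) C[q²] j
  C = suc (j +ℕ k) C[q²] suc j
  E = ∏1-q^ evens (suc (j +ℕ k)) · 1ₛ
  IH₁ : ∏1-q^ evens j · ∏1-q^ evens (suc k) · A ≈ E
  IH₁ = subst (λ n → ∏1-q^ evens j · ∏1-q^ evens (suc k) · (n C[q²] j) ≈ ∏1-q^ evens n · 1ₛ)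
              (ℕ.+-suc j k) (C[q²]-factorial j (suc k))
  exponent : ∀ j k → suc (suc (j +ℕ j)) +ℕ suc (suc (k +ℕ k)) ≡ suc (suc (suc (j +ℕ k) +ℕ suc (j +ℕ k)))
  exponent = ℕ-solve-∀

-- C[q²]-factorial (suc j) (k - 1), multiplied by 1 - q^(2k) so that it also holds for k = 0.
C[q²]-factorial-suc : ∀ j k → ∏1-q^ evens (suc j) · ∏1-q^ evens k · ((j +ℕ k) C[q²] suc j) ≈ 1-q^ k +ℕ k · ∏1-q^ evens (j +ℕ k) · 1ₛ
C[q²]-factorial-suc j zero = begin
  ∏1-q^ evens (suc j) · ((j +ℕ 0) C[q²] suc j)      ≈⟨ mul-cong (∏1-q^-isMultiplier (evens (suc j))) (C[q²]-above (j +ℕ 0) (suc j) j+0<1+j) ⟩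
  ∏1-q^ evens (suc j) · 0ₛ                          ≈⟨ mul-0ₛ (∏1-q^-isMultiplier (evens (suc j))) ⟩
  0ₛ                                                ≈⟨ mk≈ (λ n → sym (ℤ.+-inverseʳ (E n))) ⟩
  1-q^ 0 · E                                        ∎
  where
  open ≈-Reasoning
  E = ∏1-q^ evens (j +ℕ 0) · 1ₛ
  j+0<1+j = s≤s (ℕ.≤-reflexive (ℕ.+-identityʳ j))
C[q²]-factorial-suc j (suc k) rewrite ℕ.+-suc j k = begin
  ∏1-q^ evens (suc j) · 1-q^ 2* k +2 · ∏1-q^ evens k · C  ≈⟨ mul-1-q^-comm (∏1-q^-isMultiplier (evens (suc j))) (2* k +2) _ ⟩
  1-q^ 2* k +2 · ∏1-q^ evens (suc j) · ∏1-q^ evens k · C  ≈⟨ 1-q^-cong (2* k +2) (C[q²]-factorial (suc j) k) ⟩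
  1-q^ 2* k +2 · ∏1-q^ evens (suc (j +ℕ k)) · 1ₛ          ≈⟨ 1-q^-≡ (∏1-q^ evens (suc (j +ℕ k)) · 1ₛ) (cong suc (sym (ℕ.+-suc k k))) ⟩
  1-q^ suc k +ℕ suc k · ∏1-q^ evens (suc (j +ℕ k)) · 1ₛ   ∎
  where
  open ≈-Reasoning
  C = suc (j +ℕ k) C[q²] suc j

C[q²]-pascal′ : ∀ {n} j k → j +ℕ k ≡ n → suc n C[q²] suc j ≈ q^ k +ℕ k · (n C[q²] j) ⊕ n C[q²] suc j
C[q²]-pascal′ j k refl = ∏evens-cancel (suc j) k (begin
  P (suc (j +ℕ k) C[q²] suc j)                     ≈⟨ C[q²]-factorial (suc j) k ⟩
  ∏1-q^ evens (suc (j +ℕ k)) · 1ₛ                  ≈⟨ 1-q^-≡ E (exponent j k) ⟩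
  1-q^ k +ℕ k +ℕ 2* j +2 · E                       ≈⟨ ≈-sym (1-q^-+ (k +ℕ k) (2* j +2) E) ⟩
  1-q^ k +ℕ k · E ⊕ q^ k +ℕ k · 1-q^ 2* j +2 · E   ≈⟨ ⊕-comm (1-q^ k +ℕ k · E) _ ⟩
  q^ k +ℕ k · 1-q^ 2* j +2 · E ⊕ 1-q^ k +ℕ k · E   ≈⟨ ⊕-cong (q^-cong (k +ℕ k) (1-q^-cong (2* j +2) (≈-sym (C[q²]-factorial j k))))
                                                              (≈-sym (C[q²]-factorial-suc j k)) ⟩
  q^ k +ℕ k · P A ⊕ P C                            ≈⟨ ⊕-congˡ (P C) (≈-sym (mul-q^ M (k +ℕ k) A)) ⟩
  P (q^ k +ℕ k · A) ⊕ P C                          ≈⟨ ≈-sym (mul-⊕ M _ C) ⟩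
  P (q^ k +ℕ k · A ⊕ C)                            ∎)
  where
  open ≈-Reasoning
  P : Series → Series
  P f = ∏1-q^ evens (suc j) · ∏1-q^ evens k · f
  M = ∏evens-isMultiplier (suc j) k
  A = (j +ℕ k) C[q²] j
  C = (j +ℕ k) C[q²] suc j
  E = ∏1-q^ evens (j +ℕ k) · 1ₛ
  exponent : ∀ j k → suc (suc ((j +ℕ k) +ℕ (j +ℕ k))) ≡ k +ℕ k +ℕ suc (suc (j +ℕ j))
  exponent = ℕ-solve-∀

-- A finite form of the Jacobi triple product:
--   ∑_{j ≤ 2m} (-1)^j q^((j-m)²) [2m choose j]_{q²} = (-1)^m (q;q²)_m²

-1^_ : ℕ → ℤ
-1^ zero  = 1ℤ
-1^ suc k = - (-1^ k)

-1^-+ : ∀ a b → -1^ (a +ℕ b) ≡ -1^ a * -1^ b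
-1^-+ zero    b = sym (ℤ.*-identityˡ (-1^ b))
-1^-+ (suc a) b = trans (cong -_ (-1^-+ a b)) (ℤ.neg-distribˡ-* (-1^ a) (-1^ b))

-1^-square : ∀ a → -1^ a * -1^ a ≡ 1ℤ
-1^-square zero    = refl
-1^-square (suc a) = trans (neg-square (-1^ a)) (-1^-square a)
  where
  neg-square : ∀ x → - x * - x ≡ x * x
  neg-square = solve-∀

-1^-double : ∀ i → -1^ (i +ℕ i) ≡ 1ℤ
-1^-double i = trans (-1^-+ i i) (-1^-square i)

-1^-⊛-involutive : ∀ m f → -1^ m ⊛ -1^ m ⊛ f ≈ f
-1^-⊛-involutive m f = mk≈ (λ n →
  trans (sym (ℤ.*-assoc (-1^ m) (-1^ m) (f n))) (trans (cong (_* f n) (-1^-square m)) (ℤ.*-identityˡ (f n))))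

-- sqdist j m = (j - m)², computed without truncated subtraction.
sqdist : ℕ → ℕ → ℕ
sqdist zero    m       = m *ℕ m
sqdist (suc j) zero    = suc j *ℕ suc j
sqdist (suc j) (suc m) = sqdist j m

sqdist-+ˡ : ∀ m t → sqdist (m +ℕ t) m ≡ t *ℕ t
sqdist-+ˡ zero    zero    = refl
sqdist-+ˡ zero    (suc t) = refl
sqdist-+ˡ (suc m) t       = sqdist-+ˡ m t

sqdist-+ʳ : ∀ j t → sqdist j (j +ℕ t) ≡ t *ℕ t
sqdist-+ʳ zero    t = refl
sqdist-+ʳ (suc j) t = sqdist-+ʳ j t

sqdist-suc : ∀ i m → sqdist i m +ℕ 2* i +2 ≡ 2* m +1 +ℕ sqdist (suc i) m
sqdist-suc zero    zero    = refl
sqdist-suc zero    (suc m) = identity m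
  where
  identity : ∀ m → suc m *ℕ suc m +ℕ 2 ≡ suc (suc m +ℕ suc m) +ℕ m *ℕ m
  identity = ℕ-solve-∀
sqdist-suc (suc i) zero    = identity i
  where
  identity : ∀ i → suc i *ℕ suc i +ℕ suc (suc (suc i +ℕ suc i)) ≡ 1 +ℕ suc (suc i) *ℕ suc (suc i)
  identity = ℕ-solve-∀
sqdist-suc (suc i) (suc m) = begin
  sqdist i m +ℕ suc (suc (suc i +ℕ suc i))     ≡⟨ step₁ (sqdist i m) i ⟩
  2 +ℕ (sqdist i m +ℕ suc (suc (i +ℕ i)))      ≡⟨ cong (2 +ℕ_) (sqdist-suc i m) ⟩
  2 +ℕ (suc (m +ℕ m) +ℕ sqdist (suc i) m)      ≡⟨ step₂ m (sqdist (suc i) m) ⟩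
  suc (suc m +ℕ suc m) +ℕ sqdist (suc i) m     ∎
  where
  open ≡-Reasoning
  step₁ : ∀ d i → d +ℕ suc (suc (suc i +ℕ suc i)) ≡ 2 +ℕ (d +ℕ suc (suc (i +ℕ i)))
  step₁ = ℕ-solve-∀
  step₂ : ∀ m d → 2 +ℕ (suc (m +ℕ m) +ℕ d) ≡ suc (suc m +ℕ suc m) +ℕ d
  step₂ = ℕ-solve-∀

sqdist-lower : ∀ m i k → suc i +ℕ k ≡ m +ℕ m → sqdist (suc i) m +ℕ (suc k +ℕ suc k) ≡ 2* m +1 +ℕ sqdist i m
sqdist-lower m i k i+k≡n = ℕ.+-cancelʳ-≡ (2* m +1) _ _ (begin
  D +ℕ (suc k +ℕ suc k) +ℕ 2* m +1                       ≡⟨ rearrange₁ D k (2* m +1) ⟩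
  (2* m +1 +ℕ D) +ℕ (suc k +ℕ suc k)                     ≡⟨ cong (_+ℕ (suc k +ℕ suc k)) (sym (sqdist-suc i m)) ⟩
  sqdist i m +ℕ 2* i +2 +ℕ (suc k +ℕ suc k)              ≡⟨ rearrange₂ (sqdist i m) i k ⟩
  sqdist i m +ℕ suc (suc ((suc i +ℕ k) +ℕ (suc i +ℕ k))) ≡⟨ cong (λ z → sqdist i m +ℕ suc (suc (z +ℕ z))) i+k≡n ⟩
  sqdist i m +ℕ suc (suc ((m +ℕ m) +ℕ (m +ℕ m)))         ≡⟨ rearrange₃ (sqdist i m) m ⟩
  2* m +1 +ℕ sqdist i m +ℕ 2* m +1                       ∎)
  where
  open ≡-Reasoning
  D = sqdist (suc i) m
  rearrange₁ : ∀ a k c → a +ℕ (suc k +ℕ suc k) +ℕ c ≡ (c +ℕ a) +ℕ (suc k +ℕ suc k)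
  rearrange₁ = ℕ-solve-∀
  rearrange₂ : ∀ b i k → b +ℕ suc (suc (i +ℕ i)) +ℕ (suc k +ℕ suc k) ≡ b +ℕ suc (suc ((suc i +ℕ k) +ℕ (suc i +ℕ k)))
  rearrange₂ = ℕ-solve-∀
  rearrange₃ : ∀ b m → b +ℕ suc (suc ((m +ℕ m) +ℕ (m +ℕ m))) ≡ suc (m +ℕ m) +ℕ b +ℕ suc (m +ℕ m)
  rearrange₃ = ℕ-solve-∀

sqdist-upper : ∀ m i k → i +ℕ k ≡ m +ℕ m → sqdist i m +ℕ 2* i +2 +ℕ (k +ℕ k) ≡ (2* m +1 +ℕ 2* m +1) +ℕ sqdist i m
sqdist-upper m i k i+k≡n = begin
  D +ℕ suc (suc (i +ℕ i)) +ℕ (k +ℕ k)        ≡⟨ rearrange₁ D i k ⟩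
  D +ℕ suc (suc ((i +ℕ k) +ℕ (i +ℕ k)))      ≡⟨ cong (λ z → D +ℕ suc (suc (z +ℕ z))) i+k≡n ⟩
  D +ℕ suc (suc ((m +ℕ m) +ℕ (m +ℕ m)))      ≡⟨ rearrange₂ D m ⟩
  (2* m +1 +ℕ 2* m +1) +ℕ D                  ∎
  where
  open ≡-Reasoning
  D = sqdist i m
  rearrange₁ : ∀ d i k → d +ℕ suc (suc (i +ℕ i)) +ℕ (k +ℕ k) ≡ d +ℕ suc (suc ((i +ℕ k) +ℕ (i +ℕ k)))
  rearrange₁ = ℕ-solve-∀
  rearrange₂ : ∀ d m → d +ℕ suc (suc ((m +ℕ m) +ℕ (m +ℕ m))) ≡ (suc (m +ℕ m) +ℕ suc (m +ℕ m)) +ℕ d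
  rearrange₂ = ℕ-solve-∀

gaussTerm : ℕ → ℕ → Series
gaussTerm m j = q^ sqdist j m · ((m +ℕ m) C[q²] j)

gaussTerm-vanishes : ∀ m j → suc (m +ℕ m) ≤ j → gaussTerm m j ≈ 0ₛ
gaussTerm-vanishes m j le = mk≈ (λ x → q^-of-0 (sqdist j m) x (C[q²]-above (m +ℕ m) j le))

prev : (ℕ → Series) → ℕ → Series
prev u zero    = 0ₛ
prev u (suc i) = u i

gaussTerm-suc-zero : ∀ m → gaussTerm (suc m) 0 ≈ q^ 2* m +1 · gaussTerm m 0
gaussTerm-suc-zero m = ≈-trans (q^-≡ 1ₛ (exponent m)) (≈-sym (q^-q^ (2* m +1) (m *ℕ m) 1ₛ))
  where
  exponent : ∀ m → suc m *ℕ suc m ≡ suc (m +ℕ m) +ℕ m *ℕ m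
  exponent = ℕ-solve-∀

module GaussTermRecurrence (m : ℕ) where

  n = m +ℕ m

  Recurrence : ℕ → Set
  Recurrence i = gaussTerm (suc m) (suc i) ≈
    q^ 2* m +1 · gaussTerm m (suc i) ⊕ gaussTerm m i ⊕ q^ 2* m +1 +ℕ 2* m +1 · gaussTerm m i ⊕ q^ 2* m +1 · prev (gaussTerm m) i

  top : Recurrence (suc n)
  top = ≈-trans lhs (≈-sym rhs)
    where
    exponent : ∀ m → suc m *ℕ suc m ≡ suc (m +ℕ m) +ℕ m *ℕ m
    exponent = ℕ-solve-∀
    lhs : gaussTerm (suc m) (suc (suc n)) ≈ q^ 2* m +1 +ℕ sqdist n m · 1ₛ
    lhs = begin
      q^ sqdist (suc n) m · (suc m +ℕ suc m) C[q²] suc (suc n)  ≈⟨ q^-cong (sqdist (suc n) m) (≡⇒≈ (cong (λ M → suc M C[q²] suc (suc n)) (ℕ.+-suc m m))) ⟩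
      q^ sqdist (suc n) m · suc (suc n) C[q²] suc (suc n)        ≈⟨ q^-cong (sqdist (suc n) m) (C[q²]-diag (suc (suc n))) ⟩
      q^ sqdist (suc n) m · 1ₛ                                  ≈⟨ q^-≡ 1ₛ (trans (cong (λ j → sqdist j m) (sym (ℕ.+-suc m m)))
                                                                                     (sqdist-+ˡ m (suc m))) ⟩
      q^ suc m *ℕ suc m · 1ₛ                                    ≈⟨ q^-≡ 1ₛ (trans (exponent m) (cong (2* m +1 +ℕ_) (sym (sqdist-+ˡ m m)))) ⟩
      q^ 2* m +1 +ℕ sqdist n m · 1ₛ                              ∎
      where open ≈-Reasoning
    rhs : q^ 2* m +1 · gaussTerm m (suc (suc n)) ⊕ gaussTerm m (suc n) ⊕ q^ 2* m +1 +ℕ 2* m +1 · gaussTerm m (suc n)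
            ⊕ q^ 2* m +1 · gaussTerm m n ≈ q^ 2* m +1 +ℕ sqdist n m · 1ₛ
    rhs = mk≈ λ x → trans (drop-zeros _ _ _ _ (q^-of-0 (2* m +1) x (gaussTerm-vanishes m (suc (suc n)) (ℕ.n≤1+n _)))
                                              (coeff (gaussTerm-vanishes m (suc n) ℕ.≤-refl) x)
                                              (q^-of-0 (2* m +1 +ℕ 2* m +1) x (gaussTerm-vanishes m (suc n) ℕ.≤-refl)))
                          (trans (coeff (q^-cong (2* m +1) (q^-cong (sqdist n m) (C[q²]-diag n))) x) (q^-+ (2* m +1) (sqdist n m) 1ₛ x))
      where
      drop-zeros : ∀ a b c d → a ≡ 0ℤ → b ≡ 0ℤ → c ≡ 0ℤ → a + b + c + d ≡ d
      drop-zeros a b c d refl refl refl = ℤ.+-identityˡ d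

  -- the part of  [2m+2 choose i+1]  coming from  [2m+1 choose i]
  lower-part : ∀ i k → i +ℕ k ≡ n →
               q^ sqdist i m · (suc n C[q²] i) ≈ gaussTerm m i ⊕ q^ 2* m +1 · prev (gaussTerm m) i
  lower-part zero k _ = mk≈ (λ x → sym (trans (cong (_+_ (gaussTerm m 0 x)) (q^-0ₛ (2* m +1) x)) (ℤ.+-identityʳ _)))
  lower-part (suc i) k i+k≡n = begin
    q^ D · (suc n C[q²] suc i)                                           ≈⟨ q^-cong D (C[q²]-pascal′ i (suc k) (trans (ℕ.+-suc i k) i+k≡n)) ⟩
    q^ D · (q^ suc k +ℕ suc k · (n C[q²] i) ⊕ n C[q²] suc i)           ≈⟨ mul-⊕ (q^-isMultiplier D) _ _ ⟩
    q^ D · q^ suc k +ℕ suc k · (n C[q²] i) ⊕ gaussTerm m (suc i)       ≈⟨ ⊕-congˡ (gaussTerm m (suc i))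
                                                                             (q^-q^-≡ D (suc k +ℕ suc k) (2* m +1) (sqdist i m) (n C[q²] i) (sqdist-lower m i k i+k≡n)) ⟩
    q^ 2* m +1 · gaussTerm m i ⊕ gaussTerm m (suc i)                    ≈⟨ ⊕-comm (q^ 2* m +1 · gaussTerm m i) (gaussTerm m (suc i)) ⟩
    gaussTerm m (suc i) ⊕ q^ 2* m +1 · gaussTerm m i                    ∎
    where
    open ≈-Reasoning
    D = sqdist (suc i) m
  -- the part of  [2m+2 choose i+1]  coming from  q^(2i+2) [2m+1 choose i+1]
  upper-part : ∀ i k → i +ℕ k ≡ n →
               q^ sqdist i m · q^ 2* i +2 · (suc n C[q²] suc i) ≈
               q^ 2* m +1 +ℕ 2* m +1 · gaussTerm m i ⊕ q^ 2* m +1 · gaussTerm m (suc i)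
  upper-part i k i+k≡n = begin
    q^ D · q^ 2* i +2 · (suc n C[q²] suc i)                                 ≈⟨ q^-q^ D _ _ ⟩
    q^ D +ℕ 2* i +2 · (suc n C[q²] suc i)                                   ≈⟨ q^-cong (D +ℕ 2* i +2) (C[q²]-pascal′ i k i+k≡n) ⟩
    q^ D +ℕ 2* i +2 · (q^ k +ℕ k · (n C[q²] i) ⊕ n C[q²] suc i)           ≈⟨ mul-⊕ (q^-isMultiplier (D +ℕ 2* i +2)) _ _ ⟩
    q^ D +ℕ 2* i +2 · q^ k +ℕ k · (n C[q²] i) ⊕ q^ D +ℕ 2* i +2 · (n C[q²] suc i)
      ≈⟨ ⊕-cong (q^-q^-≡ (D +ℕ 2* i +2) (k +ℕ k) (2* m +1 +ℕ 2* m +1) D (n C[q²] i) (sqdist-upper m i k i+k≡n))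
                (≈-trans (q^-≡ (n C[q²] suc i) (sqdist-suc i m)) (≈-sym (q^-q^ (2* m +1) (sqdist (suc i) m) (n C[q²] suc i)))) ⟩
    q^ 2* m +1 +ℕ 2* m +1 · gaussTerm m i ⊕ q^ 2* m +1 · gaussTerm m (suc i) ∎
    where
    open ≈-Reasoning
    D = sqdist i m

  inner : ∀ i k → i +ℕ k ≡ n → Recurrence i
  inner i k i+k≡n = begin
    q^ D · ((suc m +ℕ suc m) C[q²] suc i)                                ≈⟨ q^-cong D (≡⇒≈ (cong (_C[q²] suc i) (cong suc (ℕ.+-suc m m)))) ⟩
    q^ D · (suc n C[q²] i ⊕ q^ 2* i +2 · (suc n C[q²] suc i))            ≈⟨ mul-⊕ (q^-isMultiplier D) _ _ ⟩
    q^ D · (suc n C[q²] i) ⊕ q^ D · q^ 2* i +2 · (suc n C[q²] suc i)    ≈⟨ ⊕-cong (lower-part i k i+k≡n) (upper-part i k i+k≡n) ⟩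
    (G i ⊕ q^ 2* m +1 · prev G i) ⊕ (q^ 2* m +1 +ℕ 2* m +1 · G i ⊕ q^ 2* m +1 · G (suc i))
      ≈⟨ mk≈ (λ x → rearrange (G i x) ((q^ 2* m +1 · prev G i) x) ((q^ 2* m +1 +ℕ 2* m +1 · G i) x) ((q^ 2* m +1 · G (suc i)) x)) ⟩
    q^ 2* m +1 · G (suc i) ⊕ G i ⊕ q^ 2* m +1 +ℕ 2* m +1 · G i ⊕ q^ 2* m +1 · prev (gaussTerm m) i ∎
    where
    open ≈-Reasoning
    D = sqdist i m
    G = gaussTerm m
    rearrange : ∀ a b c d → (a + b) + (c + d) ≡ d + a + c + b
    rearrange = solve-∀

gaussTerm-suc-suc : ∀ m i → i ≤ 2* m +1 → GaussTermRecurrence.Recurrence m i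
gaussTerm-suc-suc m i i≤ with ℕ.m≤n⇒m<n∨m≡n i≤
... | inj₂ refl = GaussTermRecurrence.top m
... | inj₁ i<   = GaussTermRecurrence.inner m i (m +ℕ m ∸ i) (ℕ.m+[n∸m]≡n (ℕ.≤-pred i<))

∑±< : ℕ → (ℕ → Series) → Series
∑±< L u = ∑ₛ< L (λ j → -1^ j ⊛ u j)

gaussSum : ℕ → Series
gaussSum m = ∑±< (suc (m +ℕ m)) (gaussTerm m)

∑±<-recurrence : ∀ a L (u v : ℕ → Series) →
  (∀ j → L ≤ j → u j ≈ 0ₛ) →
  v 0 ≈ q^ a · u 0 →
  (∀ i → i ≤ L → v (suc i) ≈ q^ a · u (suc i) ⊕ u i ⊕ q^ a +ℕ a · u i ⊕ q^ a · prev u i) →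
  ∑±< (suc (suc L)) v ≈ - 1ℤ ⊛ 1-q^ a · 1-q^ a · ∑±< L u
∑±<-recurrence a L u v u-vanishes v-zero v-suc = mk≈ λ x → trans (lhs x) (sym (rhs x))
  where
  alt : ℕ → (ℕ → ℤ) → ℤ
  alt M w = ∑< M (λ j → -1^ j * w j)

  U A B P : ℕ → ℕ → ℤ
  U x j = u j x
  A x j = (q^ a · u j) x
  B x j = (q^ a +ℕ a · u j) x
  P x i = (q^ a · prev u i) x

  alt-stable : ∀ M (w : ℕ → ℤ) → L ≤ M → (∀ j → L ≤ j → w j ≡ 0ℤ) → alt M w ≡ alt L w
  alt-stable M w L≤M w-zero = sym (∑<-extend L M (λ j → -1^ j * w j) L≤M
                                      (λ j L≤j → trans (cong (-1^ j *_) (w-zero j L≤j)) (ℤ.*-zeroʳ (-1^ j))))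

  q^-alt : ∀ b x → (q^ b · ∑±< L u) x ≡ alt L (λ j → (q^ b · u j) x)
  q^-alt b x = trans (coeff (mul-∑ₛ< (q^-isMultiplier b) L (λ j → -1^ j ⊛ u j)) x)
                     (∑<-cong L (λ j → q^-⊛ b (-1^ j) (u j) x))

  termwise : ∀ x i → i ≤ L → -1^ suc i * v (suc i) x ≡
    (-1^ suc i * A x (suc i) + - (-1^ i * U x i)) + (- (-1^ i * B x i) + -1^ suc i * P x i)
  termwise x i i≤L = trans (cong (-1^ suc i *_) (coeff (v-suc i i≤L) x))
                           (distribute (-1^ i) (A x (suc i)) (U x i) (B x i) (P x i))
    where
    distribute : ∀ s p q r t → - s * (p + q + r + t) ≡ (- s * p + - (s * q)) + (- (s * r) + - s * t)
    distribute = solve-∀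

  prev-part : ∀ x → ∑< (suc L) (λ i → -1^ suc i * P x i) ≡ alt L (A x)
  prev-part x = trans (cong₂ _+_ (cong (- 1ℤ *_) (q^-0ₛ a x))
                                 (∑<-cong L (λ k → cong (_* A x k) (ℤ.neg-involutive (-1^ k)))))
                      (ℤ.+-identityˡ (alt L (A x)))

  lhs : ∀ x → ∑±< (suc (suc L)) v x ≡ (alt L (A x) - alt L (U x)) - (alt L (B x) - alt L (A x))
  lhs x = begin
    1ℤ * v 0 x + ∑< (suc L) (λ i → -1^ suc i * v (suc i) x)
      ≡⟨ cong₂ _+_ (cong (1ℤ *_) (coeff v-zero x)) (∑<-cong-< (suc L) (λ i i<sL → termwise x i (ℕ.≤-pred i<sL))) ⟩
    1ℤ * A x 0 + ∑< (suc L) (λ i → (a₁ i + a₂ i) + (a₃ i + a₄ i))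
      ≡⟨ cong (_+_ (1ℤ * A x 0)) (trans (∑<-+ (suc L) (λ i → a₁ i + a₂ i) (λ i → a₃ i + a₄ i)) (cong₂ _+_ (∑<-+ (suc L) a₁ a₂) (∑<-+ (suc L) a₃ a₄))) ⟩
    1ℤ * A x 0 + ((∑< (suc L) a₁ + ∑< (suc L) a₂) + (∑< (suc L) a₃ + ∑< (suc L) a₄))
      ≡⟨ cong (_+_ (1ℤ * A x 0)) (cong₂ _+_ (cong (_+_ (∑< (suc L) a₁)) (∑<-neg (suc L) (λ i → -1^ i * U x i)))
                                            (cong₂ _+_ (∑<-neg (suc L) (λ i → -1^ i * B x i)) (prev-part x))) ⟩
    1ℤ * A x 0 + ((∑< (suc L) a₁ + - alt (suc L) (U x)) + (- alt (suc L) (B x) + alt L (A x)))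
      ≡⟨ regroup (1ℤ * A x 0) (∑< (suc L) a₁) (alt (suc L) (U x)) (alt (suc L) (B x)) (alt L (A x)) ⟩
    (alt (suc (suc L)) (A x) - alt (suc L) (U x)) - (alt (suc L) (B x) - alt L (A x))
      ≡⟨ cong₂ (λ p q → (p - q) - (alt (suc L) (B x) - alt L (A x)))
               (alt-stable (suc (suc L)) (A x) (ℕ.m≤n⇒m≤1+n (ℕ.n≤1+n L)) (λ j L≤j → q^-of-0 a x (u-vanishes j L≤j)))
               (alt-stable (suc L) (U x) (ℕ.n≤1+n L) (λ j L≤j → coeff (u-vanishes j L≤j) x)) ⟩
    (alt L (A x) - alt L (U x)) - (alt (suc L) (B x) - alt L (A x))
      ≡⟨ cong (λ r → (alt L (A x) - alt L (U x)) - (r - alt L (A x)))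
              (alt-stable (suc L) (B x) (ℕ.n≤1+n L) (λ j L≤j → q^-of-0 (a +ℕ a) x (u-vanishes j L≤j))) ⟩
    (alt L (A x) - alt L (U x)) - (alt L (B x) - alt L (A x)) ∎
    where
    open ≡-Reasoning
    a₁ a₂ a₃ a₄ : ℕ → ℤ
    a₁ i = -1^ suc i * A x (suc i)
    a₂ i = - (-1^ i * U x i)
    a₃ i = - (-1^ i * B x i)
    a₄ i = -1^ suc i * P x i
    regroup : ∀ a₀ s₁ nu nb s₄ → a₀ + ((s₁ + - nu) + (- nb + s₄)) ≡ ((a₀ + s₁) - nu) - (nb - s₄)
    regroup = solve-∀

  rhs : ∀ x → (- 1ℤ ⊛ 1-q^ a · 1-q^ a · ∑±< L u) x ≡ (alt L (A x) - alt L (U x)) - (alt L (B x) - alt L (A x))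
  rhs x = trans (cong (- 1ℤ *_) (cong₂ _-_ (cong (_-_ (S x)) (q^-alt a x))
                                          (trans (q^-map₂ a _-_ refl S (q^ a · S) x)
                                                 (cong₂ _-_ (q^-alt a x) (trans (q^-+ a a S x) (q^-alt (a +ℕ a) x))))))
                (expand (alt L (U x)) (alt L (A x)) (alt L (B x)))
    where
    S = ∑±< L u
    expand : ∀ s sa sb → - 1ℤ * ((s - sa) - (sa - sb)) ≡ (sa - s) - (sb - sa)
    expand = solve-∀

finite-theta : ∀ m → gaussSum m ≈ -1^ m ⊛ ∏1-q^ odds m · ∏1-q^ odds m · 1ₛ
finite-theta zero    = mk≈ (λ x → ℤ.+-identityʳ (1ℤ * 1ₛ x))
finite-theta (suc m) = begin
  gaussSum (suc m)                                                     ≈⟨ ≡⇒≈ (cong (λ L → ∑±< L (gaussTerm (suc m))) (cong suc (ℕ.+-suc (suc m) m))) ⟩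
  ∑±< (suc (suc (2* m +1))) (gaussTerm (suc m))                        ≈⟨ ∑±<-recurrence (2* m +1) (2* m +1) (gaussTerm m) (gaussTerm (suc m))
                                                                            (gaussTerm-vanishes m) (gaussTerm-suc-zero m) (gaussTerm-suc-suc m) ⟩
  - 1ℤ ⊛ F (gaussSum m)                                                ≈⟨ ⊛-cong (- 1ℤ) (mul-cong F-mul (finite-theta m)) ⟩
  - 1ℤ ⊛ F (-1^ m ⊛ Θ)                                                 ≈⟨ ⊛-cong (- 1ℤ) (mul-⊛ F-mul (-1^ m) Θ) ⟩
  - 1ℤ ⊛ -1^ m ⊛ F Θ                                                   ≈⟨ mk≈ (λ x → trans (sym (ℤ.*-assoc (- 1ℤ) (-1^ m) _)) (cong (_* F Θ x) (ℤ.-1*i≡-i (-1^ m)))) ⟩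
  -1^ suc m ⊛ F Θ
    ≈⟨ ⊛-cong (-1^ suc m) (1-q^-cong (2* m +1) (≈-sym (mul-1-q^-comm (∏1-q^-isMultiplier (odds m)) (2* m +1) _))) ⟩
  -1^ suc m ⊛ ∏1-q^ odds (suc m) · ∏1-q^ odds (suc m) · 1ₛ             ∎
  where
  open ≈-Reasoning
  F : Series → Series
  F f = 1-q^ 2* m +1 · 1-q^ 2* m +1 · f
  F-mul = ∘-isMultiplier (1-q^-isMultiplier (2* m +1)) (1-q^-isMultiplier (2* m +1))
  Θ = ∏1-q^ odds m · ∏1-q^ odds m · 1ₛ

evensAbove : ℕ → ℕ → List ℕ
evensAbove k zero    = []
evensAbove k (suc u) = 2* (u +ℕ k) +2 ∷ evensAbove k u

evens-+ : ∀ u k → evens (u +ℕ k) ≡ evensAbove k u ++ evens k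
evens-+ zero    k = refl
evens-+ (suc u) k = cong (2* (u +ℕ k) +2 ∷_) (evens-+ u k)

evensAbove-≥ : ∀ k u {B} → B ≤ 2* k +2 → All (B ≤_) (evensAbove k u)
evensAbove-≥ k zero    _   = []
evensAbove-≥ k (suc u) B≤ = ℕ.≤-trans B≤ 2k+2≤ ∷ evensAbove-≥ k u B≤
  where
  2k+2≤ = s≤s (s≤s (ℕ.+-mono-≤ (ℕ.m≤n+m k u) (ℕ.m≤n+m k u)))

∏evens-+ : ∀ u k f → ∏1-q^ evens (u +ℕ k) · f ≡ ∏1-q^ evensAbove k u · ∏1-q^ evens k · f
∏evens-+ u k f = trans (cong (∏1-q^_· f) (evens-+ u k)) (∏1-q^-++ (evensAbove k u) (evens k) f)

-- If X = (q²;q²)_{u+k} / ((q²;q²)_u (q²;q²)_k) with u ≤ k, then every factor left in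
-- (q²;q²)_{t+u} X is some 1 - q^{2i} with 2i ≥ 2u+2.
∏evens-quotient : ∀ u k t X → u ≤ k → ∏1-q^ evens u · ∏1-q^ evens k · X ≈ ∏1-q^ evens (u +ℕ k) · 1ₛ →
                  ∏1-q^ evens (t +ℕ u) · X ≈[ 2* u +2 ] 1ₛ
∏evens-quotient u k t X u≤k quotient = begin
  ∏1-q^ evens (t +ℕ u) · X                                    ≡⟨ ∏evens-+ t u X ⟩
  ∏1-q^ evensAbove u t · ∏1-q^ evens u · X                    ≈⟨ ≈⇒≈[] (mul-cong (∏1-q^-isMultiplier (evensAbove u t)) cancelled) ⟩
  ∏1-q^ evensAbove u t · ∏1-q^ evensAbove k u · 1ₛ            ≈⟨ ∏1-q^-≈[]-id (evensAbove u t) _ (evensAbove-≥ u t ℕ.≤-refl) ⟩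
  ∏1-q^ evensAbove k u · 1ₛ                                   ≈⟨ ∏1-q^-≈[]-id (evensAbove k u) 1ₛ (evensAbove-≥ k u 2u+2≤2k+2) ⟩
  1ₛ                                                          ∎
  where
  open ≈[]-Reasoning (2* u +2)
  2u+2≤2k+2 = s≤s (s≤s (ℕ.+-mono-≤ u≤k u≤k))
  cancelled : ∏1-q^ evens u · X ≈ ∏1-q^ evensAbove k u · 1ₛ
  cancelled = ∏1-q^-cancel (evens k) (evens-positive k) (≈-trans
    (≈-sym (mul-∏1-q^-comm (∏1-q^-isMultiplier (evens u)) (evens k) X))
    (≈-trans quotient (≈-trans (≡⇒≈ (∏evens-+ u k 1ₛ))
                               (≈-sym (mul-∏1-q^-comm (∏1-q^-isMultiplier (evens k)) (evensAbove k u) 1ₛ)))))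

2*+1≤square+2*+2 : ∀ t u → 2* (t +ℕ u) +1 ≤ t *ℕ t +ℕ 2* u +2
2*+1≤square+2*+2 t u = begin
  suc ((t +ℕ u) +ℕ (t +ℕ u))      ≡⟨ rearrange₁ t u ⟩
  suc ((t +ℕ t) +ℕ (u +ℕ u))      ≤⟨ s≤s (ℕ.+-monoˡ-≤ (u +ℕ u) (double≤square+1 t)) ⟩
  suc (suc (t *ℕ t) +ℕ (u +ℕ u))  ≡⟨ rearrange₂ t u ⟩
  t *ℕ t +ℕ suc (suc (u +ℕ u))    ∎
  where
  open ℕ.≤-Reasoning
  rearrange₁ : ∀ t u → suc ((t +ℕ u) +ℕ (t +ℕ u)) ≡ suc ((t +ℕ t) +ℕ (u +ℕ u))
  rearrange₁ = ℕ-solve-∀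
  rearrange₂ : ∀ t u → suc (suc (t *ℕ t) +ℕ (u +ℕ u)) ≡ t *ℕ t +ℕ suc (suc (u +ℕ u))
  rearrange₂ = ℕ-solve-∀
  double≤square+1 : ∀ t → t +ℕ t ≤ suc (t *ℕ t)
  double≤square+1 zero    = z≤n
  double≤square+1 (suc t) = ℕ.≤-trans (ℕ.m≤n+m (suc t +ℕ suc t) (t *ℕ t)) (ℕ.≤-reflexive (expand t))
    where
    expand : ∀ t → t *ℕ t +ℕ (suc t +ℕ suc t) ≡ suc (suc t *ℕ suc t)
    expand = ℕ-solve-∀

∏evens-shifted-quotient : ∀ u k t X → u ≤ k → ∏1-q^ evens u · ∏1-q^ evens k · X ≈ ∏1-q^ evens (u +ℕ k) · 1ₛ →
                          ∏1-q^ evens (t +ℕ u) · q^ t *ℕ t · X ≈[ 2* (t +ℕ u) +1 ] q^ t *ℕ t · 1ₛ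
∏evens-shifted-quotient u k t X u≤k quotient =
  ≈[]-trans (≈⇒≈[] (≈-sym (mul-∏1-q^-comm (q^-isMultiplier (t *ℕ t)) (evens (t +ℕ u)) X)))
            (≈[]-weaken (2*+1≤square+2*+2 t u) (q^-raise[] (t *ℕ t) (∏evens-quotient u k t X u≤k quotient)))

∏evens-gaussTerm : ∀ m j → j ≤ m +ℕ m → ∏1-q^ evens m · gaussTerm m j ≈[ 2* m +1 ] q^ sqdist j m · 1ₛ
∏evens-gaussTerm m j j≤2m with ℕ.≤-total j m
... | inj₁ j≤m = subst (λ M → ∏1-q^ evens M · gaussTerm M j ≈[ 2* M +1 ] q^ sqdist j M · 1ₛ)
                       (ℕ.m∸n+n≡m j≤m) (below (m ∸ j) j)
  where
  below : ∀ t j → ∏1-q^ evens (t +ℕ j) · gaussTerm (t +ℕ j) j ≈[ 2* (t +ℕ j) +1 ] q^ sqdist j (t +ℕ j) · 1ₛ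
  below t j rewrite trans (cong (sqdist j) (ℕ.+-comm t j)) (sqdist-+ʳ j t) =
    ∏evens-shifted-quotient j (t +ℕ t +ℕ j) t ((t +ℕ j +ℕ (t +ℕ j)) C[q²] j) (ℕ.m≤n+m j (t +ℕ t))
      (subst (λ N → ∏1-q^ evens j · ∏1-q^ evens (t +ℕ t +ℕ j) · (N C[q²] j) ≈ ∏1-q^ evens (j +ℕ (t +ℕ t +ℕ j)) · 1ₛ)
             (rearrange t j) (C[q²]-factorial j (t +ℕ t +ℕ j)))
    where
    rearrange : ∀ t j → j +ℕ (t +ℕ t +ℕ j) ≡ t +ℕ j +ℕ (t +ℕ j)
    rearrange = ℕ-solve-∀
... | inj₂ m≤j = subst₂ (λ M J → ∏1-q^ evens M · gaussTerm M J ≈[ 2* M +1 ] q^ sqdist J M · 1ₛ)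
                        t+u≡m t+u+t≡j (above t u)
  where
  t = j ∸ m
  u = m ∸ t
  t≤m : t ≤ m
  t≤m = ℕ.≤-trans (ℕ.∸-monoˡ-≤ m j≤2m) (ℕ.≤-reflexive (ℕ.m+n∸m≡n m m))
  t+u≡m : t +ℕ u ≡ m
  t+u≡m = trans (ℕ.+-comm t u) (ℕ.m∸n+n≡m t≤m)
  t+u+t≡j : t +ℕ u +ℕ t ≡ j
  t+u+t≡j = trans (cong (_+ℕ t) t+u≡m) (trans (ℕ.+-comm m t) (ℕ.m∸n+n≡m m≤j))
  above : ∀ t u → ∏1-q^ evens (t +ℕ u) · gaussTerm (t +ℕ u) (t +ℕ u +ℕ t) ≈[ 2* (t +ℕ u) +1 ] q^ sqdist (t +ℕ u +ℕ t) (t +ℕ u) · 1ₛ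
  above t u rewrite sqdist-+ˡ (t +ℕ u) t =
    ∏evens-shifted-quotient u J t X (ℕ.≤-trans (ℕ.m≤n+m u t) (ℕ.m≤m+n (t +ℕ u) t)) (begin
      ∏1-q^ evens u · ∏1-q^ evens J · X     ≈⟨ mul-∏1-q^-comm (∏1-q^-isMultiplier (evens u)) (evens J) X ⟩
      ∏1-q^ evens J · ∏1-q^ evens u · X     ≈⟨ subst (λ N → ∏1-q^ evens J · ∏1-q^ evens u · (N C[q²] J) ≈ ∏1-q^ evens N · 1ₛ)
                                                      (rearrange t u) (C[q²]-factorial J u) ⟩
      ∏1-q^ evens (t +ℕ u +ℕ (t +ℕ u)) · 1ₛ ≈⟨ ≡⇒≈ (cong (λ N → ∏1-q^ evens N · 1ₛ) (sym (rearrange′ t u))) ⟩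
      ∏1-q^ evens (u +ℕ J) · 1ₛ             ∎)
    where
    open ≈-Reasoning
    J = t +ℕ u +ℕ t
    X = (t +ℕ u +ℕ (t +ℕ u)) C[q²] J
    rearrange : ∀ t u → t +ℕ u +ℕ t +ℕ u ≡ t +ℕ u +ℕ (t +ℕ u)
    rearrange = ℕ-solve-∀
    rearrange′ : ∀ t u → u +ℕ (t +ℕ u +ℕ t) ≡ t +ℕ u +ℕ (t +ℕ u)
    rearrange′ = ℕ-solve-∀

-- Theta series

-- Multiplication by ∑_k w k q^(s k); as k < s k, only the terms k < n reach degree n.
sparseMul : (ℕ → ℤ) → (ℕ → ℕ) → Series → Series
sparseMul w s f n = ∑< n (λ k → w k * (q^ s k · f) n)

module SparseMul (w : ℕ → ℤ) (s : ℕ → ℕ) (k<s : ∀ k → k < s k) where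

  sparseMul-range : ∀ f n L → n ≤ L → sparseMul w s f n ≡ ∑< L (λ k → w k * (q^ s k · f) n)
  sparseMul-range f n L n≤L = ∑<-extend n L _ n≤L (λ k n≤k →
    trans (cong (w k *_) (q^-below (s k) f n (ℕ.≤-<-trans n≤k (k<s k)))) (ℤ.*-zeroʳ (w k)))

  sparseMul-q^ : ∀ a f → sparseMul w s (q^ a · f) ≈ q^ a · sparseMul w s f
  sparseMul-q^ a f = mk≈ at
    where
    at : ∀ n → sparseMul w s (q^ a · f) n ≡ (q^ a · sparseMul w s f) n
    at n with a ≤? n
    ... | no a≰n = trans (∑<-zero n _ (λ k _ → trans (cong (w k *_) (trans (q^-+ (s k) a f n) (q^-below (s k +ℕ a) f n n<sk+a)))
                                                     (ℤ.*-zeroʳ (w k))))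
                         (sym (q^-below a (sparseMul w s f) n (ℕ.≰⇒> a≰n)))
      where n<sk+a = λ {k} → ℕ.<-≤-trans (ℕ.≰⇒> a≰n) (ℕ.m≤n+m a (s k))
    ... | yes a≤n = subst (λ N → sparseMul w s (q^ a · f) N ≡ (q^ a · sparseMul w s f) N) (ℕ.m+[n∸m]≡n a≤n) (at-+ (n ∸ a))
      where
      at-+ : ∀ n′ → sparseMul w s (q^ a · f) (a +ℕ n′) ≡ (q^ a · sparseMul w s f) (a +ℕ n′)
      at-+ n′ = begin
        ∑< (a +ℕ n′) (λ k → w k * (q^ s k · q^ a · f) (a +ℕ n′))  ≡⟨ ∑<-cong (a +ℕ n′) (λ k → cong (w k *_)
                                                                        (trans (q^-comm (s k) a f (a +ℕ n′)) (q^-at-+ a (q^ s k · f) n′))) ⟩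
        ∑< (a +ℕ n′) (λ k → w k * (q^ s k · f) n′)               ≡⟨ sym (sparseMul-range f n′ (a +ℕ n′) (ℕ.m≤n+m n′ a)) ⟩
        sparseMul w s f n′                                       ≡⟨ sym (q^-at-+ a (sparseMul w s f) n′) ⟩
        (q^ a · sparseMul w s f) (a +ℕ n′)                       ∎
        where open ≡-Reasoning

  sparseMul-isMultiplier : IsMultiplier (sparseMul w s)
  sparseMul-isMultiplier = record
    { mul-⊕      = λ f g → mk≈ (λ n → trans (∑<-cong n (λ k → trans (cong (w k *_) (q^-⊕ (s k) f g n)) (ℤ.*-distribˡ-+ (w k) _ _)))
                                             (∑<-+ n _ _))
    ; mul-⊛      = λ z f → mk≈ (λ n → trans (∑<-cong n (λ k → trans (cong (w k *_) (q^-⊛ (s k) z f n)) (swap (w k) z _)))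
                                             (∑<-*ˡ n z _))
    ; mul-causal = λ B p → mk≈[] (λ n n<B → ∑<-cong n (λ k → cong (w k *_) (coeff< (q^-cong[] (s k) p) n n<B)))
    ; mul-q^     = sparseMul-q^ }
    where
    swap : ∀ a b c → a * (b * c) ≡ b * (a * c)
    swap = solve-∀

open SparseMul using (sparseMul-range; sparseMul-isMultiplier)

sparseMul-comm : ∀ w s v t → (∀ k → k < s k) → (∀ k → k < t k) →
                 ∀ f → sparseMul w s (sparseMul v t f) ≈ sparseMul v t (sparseMul w s f)
sparseMul-comm w s v t k<s k<t f = mk≈ λ n → begin
  ∑< n (λ k → w k * (q^ s k · sparseMul v t f) n)                ≡⟨ ∑<-cong n (λ k → cong (w k *_) (inner v t k<t (s k) n)) ⟩
  ∑< n (λ k → w k * ∑< n (λ l → v l * (q^ t l · q^ s k · f) n))  ≡⟨ ∑<-cong n (λ k → sym (∑<-*ˡ n (w k) _)) ⟩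
  ∑< n (λ k → ∑< n (λ l → w k * (v l * (q^ t l · q^ s k · f) n))) ≡⟨ ∑<-swap n n _ ⟩
  ∑< n (λ l → ∑< n (λ k → w k * (v l * (q^ t l · q^ s k · f) n))) ≡⟨ ∑<-cong n (λ l → ∑<-cong n (λ k →
                                                                       trans (cong (λ z → w k * (v l * z)) (q^-comm (t l) (s k) f n)) (swap (w k) (v l) _))) ⟩
  ∑< n (λ l → ∑< n (λ k → v l * (w k * (q^ s k · q^ t l · f) n))) ≡⟨ ∑<-cong n (λ l → ∑<-*ˡ n (v l) _) ⟩
  ∑< n (λ l → v l * ∑< n (λ k → w k * (q^ s k · q^ t l · f) n))  ≡⟨ sym (∑<-cong n (λ l → cong (v l *_) (inner w s k<s (t l) n))) ⟩
  ∑< n (λ l → v l * (q^ t l · sparseMul w s f) n)                ∎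
  where
  open ≡-Reasoning
  inner : ∀ w s (k<s : ∀ k → k < s k) a n → (q^ a · sparseMul w s f) n ≡ ∑< n (λ k → w k * (q^ s k · q^ a · f) n)
  inner w s k<s a n = trans (sym (coeff (SparseMul.sparseMul-q^ w s k<s a f) n)) (sparseMul-range w s k<s (q^ a · f) n n ℕ.≤-refl)
  swap : ∀ a b c → a * (b * c) ≡ b * (a * c)
  swap = solve-∀

infixr 8 θ₊·_ θ·_

square+1 : ℕ → ℕ
square+1 k = suc k *ℕ suc k

k<square+1 : ∀ k → k < square+1 k
k<square+1 k = s≤s (ℕ.m≤m+n k _)

-- θ₊ = ∑_{k ≥ 1} (-1)^k q^(k²)  and  θ = 1 + 2 θ₊ = ∑_{k ∈ ℤ} (-1)^k q^(k²)
θ₊·_ θ·_ : Series → Series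
θ₊· f = sparseMul (λ k → -1^ suc k) square+1 f
θ·  f = f ⊕ + 2 ⊛ θ₊· f

θ₊-isMultiplier : IsMultiplier θ₊·_
θ₊-isMultiplier = sparseMul-isMultiplier (λ k → -1^ suc k) square+1 k<square+1

θ-isMultiplier : IsMultiplier θ·_
θ-isMultiplier = ⊕-isMultiplier id-isMultiplier (⊛-isMultiplier (+ 2) θ₊-isMultiplier)

alternating-squares : ∀ m → ∑±< (suc (m +ℕ m)) (λ j → q^ sqdist j m · 1ₛ) ≈[ 2* m +1 ] -1^ m ⊛ θ· 1ₛ
alternating-squares m = mk≈[] λ x x<2m+1 → let s = term x; F = summand x in begin
  ∑< (suc (m +ℕ m)) F                                         ≡⟨ cong (λ L → ∑< L F) (sym (ℕ.+-suc m m)) ⟩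
  ∑< (m +ℕ suc m) F                                           ≡⟨ ∑<-split m (suc m) F ⟩
  ∑< m F + (F (m +ℕ 0) + ∑< m (λ k → F (m +ℕ suc k)))         ≡⟨ cong₂ _+_ (trans (∑<-reverse m F) (∑<-cong-< m (left x)))
                                                                           (cong₂ _+_ (middle x) (∑<-cong m (right x))) ⟩
  ∑< m (λ k → -1^ m * s k) + (-1^ m * 1ₛ x + ∑< m (λ k → -1^ m * s k))
                                                              ≡⟨ cong₂ (λ p q → p + (-1^ m * 1ₛ x + q)) (∑<-*ˡ m (-1^ m) s) (∑<-*ˡ m (-1^ m) s) ⟩
  -1^ m * ∑< m s + (-1^ m * 1ₛ x + -1^ m * ∑< m s)            ≡⟨ collect (-1^ m) (1ₛ x) (∑< m s) ⟩
  -1^ m * (1ₛ x + + 2 * ∑< m s)                               ≡⟨ cong (λ z → -1^ m * (1ₛ x + + 2 * z)) (stable x x<2m+1) ⟩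
  -1^ m * (1ₛ x + + 2 * ∑< x s)                               ∎
  where
  open ≡-Reasoning
  summand term : ℕ → ℕ → ℤ
  summand x j = -1^ j * (q^ sqdist j m · 1ₛ) x
  term    x k = -1^ suc k * (q^ square+1 k · 1ₛ) x

  collect : ∀ a d S → a * S + (a * d + a * S) ≡ a * (d + + 2 * S)
  collect = solve-∀

  regroup : ∀ j t y → -1^ j * (q^ sqdist j (j +ℕ t) · 1ₛ) y ≡ -1^ (j +ℕ t) * (-1^ t * (q^ t *ℕ t · 1ₛ) y)
  regroup j t y = begin
    -1^ j * (q^ sqdist j (j +ℕ t) · 1ₛ) y              ≡⟨ cong (λ e → -1^ j * (q^ e · 1ₛ) y) (sqdist-+ʳ j t) ⟩
    -1^ j * Q                                          ≡⟨ insert-square (-1^ j) (-1^ t) Q (-1^-square t) ⟩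
    (-1^ j * -1^ t) * (-1^ t * Q)                      ≡⟨ cong (_* (-1^ t * Q)) (sym (-1^-+ j t)) ⟩
    -1^ (j +ℕ t) * (-1^ t * Q)                         ∎
    where
    Q = (q^ t *ℕ t · 1ₛ) y
    insert-square : ∀ a b c → b * b ≡ 1ℤ → a * c ≡ (a * b) * (b * c)
    insert-square a b c b²≡1 = trans (sym (ℤ.*-identityʳ (a * c))) (trans (cong (a * c *_) (sym b²≡1)) (rearrange a b c))
      where
      rearrange : ∀ a b c → a * c * (b * b) ≡ (a * b) * (b * c)
      rearrange = solve-∀

  left : ∀ x k → k < m → summand x (m ∸ suc k) ≡ -1^ m * term x k
  left x k k<m = subst (λ M → summand′ M (M ∸ suc k) ≡ -1^ M * term x k) (ℕ.m∸n+n≡m k<m) at-j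
    where
    summand′ : ℕ → ℕ → ℤ
    summand′ M j = -1^ j * (q^ sqdist j M · 1ₛ) x
    j = m ∸ suc k
    at-j : summand′ (j +ℕ suc k) (j +ℕ suc k ∸ suc k) ≡ -1^ (j +ℕ suc k) * term x k
    at-j rewrite ℕ.m+n∸n≡m j (suc k) = regroup j (suc k) x

  middle : ∀ x → summand x (m +ℕ 0) ≡ -1^ m * 1ₛ x
  middle x = trans (cong (λ e → -1^ (m +ℕ 0) * (q^ e · 1ₛ) x) (sqdist-+ˡ m 0))
                   (cong (λ M → -1^ M * 1ₛ x) (ℕ.+-identityʳ m))

  right : ∀ x k → summand x (m +ℕ suc k) ≡ -1^ m * term x k
  right x k = trans (cong₂ _*_ (-1^-+ m (suc k)) (cong (λ e → (q^ e · 1ₛ) x) (sqdist-+ˡ m (suc k))))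
                    (ℤ.*-assoc (-1^ m) (-1^ suc k) _)

  stable : ∀ x → x < 2* m +1 → ∑< m (term x) ≡ ∑< x (term x)
  stable x x<2m+1 = trans (∑<-extend m (m +ℕ x) (term x) (ℕ.m≤m+n m x) beyond-m)
                   (trans (cong (λ L → ∑< L (term x)) (ℕ.+-comm m x))
                          (sym (∑<-extend x (x +ℕ m) (term x) (ℕ.m≤m+n x m) beyond-x)))
    where
    vanish : ∀ k → x < square+1 k → term x k ≡ 0ℤ
    vanish k x< = trans (cong (-1^ suc k *_) (q^-below (square+1 k) 1ₛ x x<)) (ℤ.*-zeroʳ (-1^ suc k))
    2m+1≤square+1 : 2* m +1 ≤ square+1 m
    2m+1≤square+1 = ℕ.≤-trans (ℕ.m≤m+n (2* m +1) (m *ℕ m)) (ℕ.≤-reflexive (expand m))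
      where
      expand : ∀ m → suc (m +ℕ m) +ℕ m *ℕ m ≡ suc m *ℕ suc m
      expand = ℕ-solve-∀
    beyond-m : ∀ k → m ≤ k → term x k ≡ 0ℤ
    beyond-m k m≤k = vanish k (ℕ.<-≤-trans x<2m+1 (ℕ.≤-trans 2m+1≤square+1 (ℕ.*-mono-≤ (s≤s m≤k) (s≤s m≤k))))
    beyond-x : ∀ k → x ≤ k → term x k ≡ 0ℤ
    beyond-x k x≤k = vanish k (ℕ.≤-<-trans x≤k (k<square+1 k))

theta-truncation : ∀ m → ∏1-q^ evens m · ∏1-q^ odds m · ∏1-q^ odds m · 1ₛ ≈[ 2* m +1 ] θ· 1ₛ
theta-truncation m = begin
  P Θ                                            ≈⟨ ≈⇒≈[] (≈-sym (-1^-⊛-involutive m (P Θ))) ⟩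
  -1^ m ⊛ -1^ m ⊛ P Θ                            ≈⟨ ≈⇒≈[] (⊛-cong (-1^ m) (≈-sym (mul-⊛ P-mul (-1^ m) Θ))) ⟩
  -1^ m ⊛ P (-1^ m ⊛ Θ)                          ≈⟨ ≈⇒≈[] (⊛-cong (-1^ m) (mul-cong P-mul (≈-sym (finite-theta m)))) ⟩
  -1^ m ⊛ P (gaussSum m)                         ≈⟨ ⊛-cong[] (-1^ m) (≈⇒≈[] (mul-∑ₛ< P-mul (suc (m +ℕ m)) (λ j → -1^ j ⊛ gaussTerm m j))) ⟩
  -1^ m ⊛ ∑ₛ< (suc (m +ℕ m)) (λ j → P (-1^ j ⊛ gaussTerm m j))
                                                 ≈⟨ ⊛-cong[] (-1^ m) (≈⇒≈[] (∑ₛ<-cong (suc (m +ℕ m)) (λ j → mul-⊛ P-mul (-1^ j) (gaussTerm m j)))) ⟩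
  -1^ m ⊛ ∑±< (suc (m +ℕ m)) (λ j → P (gaussTerm m j))
                                                 ≈⟨ ⊛-cong[] (-1^ m) (∑ₛ<-cong[] (suc (m +ℕ m)) (λ j j≤2m →
                                                      ⊛-cong[] (-1^ j) (∏evens-gaussTerm m j (ℕ.≤-pred j≤2m)))) ⟩
  -1^ m ⊛ ∑±< (suc (m +ℕ m)) (λ j → q^ sqdist j m · 1ₛ)
                                                 ≈⟨ ⊛-cong[] (-1^ m) (alternating-squares m) ⟩
  -1^ m ⊛ -1^ m ⊛ θ· 1ₛ                          ≈⟨ ≈⇒≈[] (-1^-⊛-involutive m (θ· 1ₛ)) ⟩
  θ· 1ₛ                                          ∎
  where
  open ≈[]-Reasoning (2* m +1)
  P : Series → Series
  P f = ∏1-q^ evens m · f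
  P-mul = ∏1-q^-isMultiplier (evens m)
  Θ = ∏1-q^ odds m · ∏1-q^ odds m · 1ₛ

-- ∏_{a ∈ jaggedExponents v} (1 - q^a) = (q;q)_v (q;q²)_v
jaggedExponents : ℕ → List ℕ
jaggedExponents v = upto v ++ odds v

jaggedExponents-positive : ∀ v → All (1 ≤_) (jaggedExponents v)
jaggedExponents-positive v = ++⁺ (upto-positive v) (odds-positive v)

oddsAbove : ℕ → ℕ → List ℕ
oddsAbove k zero    = []
oddsAbove k (suc u) = 2* (u +ℕ k) +1 ∷ oddsAbove k u

odds-+ : ∀ u k → odds (u +ℕ k) ≡ oddsAbove k u ++ odds k
odds-+ zero    k = refl
odds-+ (suc u) k = cong (2* (u +ℕ k) +1 ∷_) (odds-+ u k)

oddsAbove-≥ : ∀ k u → All (2* k +1 ≤_) (oddsAbove k u)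
oddsAbove-≥ k zero    = []
oddsAbove-≥ k (suc u) = s≤s (ℕ.+-mono-≤ (ℕ.m≤n+m k u) (ℕ.m≤n+m k u)) ∷ oddsAbove-≥ k u

upto-double : ∀ m → upto (m +ℕ m) ↭ evens m ++ odds m
upto-double zero    = ↭.refl
upto-double (suc m) rewrite ℕ.+-suc m m =
  ↭.prep (2* m +2) (↭.trans (↭.prep (2* m +1) (upto-double m)) (↭.↭-sym (↭.shift (2* m +1) (evens m) (odds m))))

jaggedExponents-double : ∀ m → jaggedExponents (m +ℕ m) ↭ evens m ++ odds m ++ odds m ++ oddsAbove m m
jaggedExponents-double m = begin
  upto (m +ℕ m) ++ odds (m +ℕ m)                        ↭⟨ ↭.++⁺ʳ (odds (m +ℕ m)) (upto-double m) ⟩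
  (evens m ++ odds m) ++ odds (m +ℕ m)                  ≡⟨ cong ((evens m ++ odds m) ++_) (odds-+ m m) ⟩
  (evens m ++ odds m) ++ oddsAbove m m ++ odds m        ≡⟨ List.++-assoc (evens m) (odds m) _ ⟩
  evens m ++ odds m ++ oddsAbove m m ++ odds m          ↭⟨ ↭.++⁺ˡ (evens m) (↭.++⁺ˡ (odds m) (↭.++-comm (oddsAbove m m) (odds m))) ⟩
  evens m ++ odds m ++ odds m ++ oddsAbove m m          ∎
  where open ↭.PermutationReasoning

∏jaggedExponents-double : ∀ m → ∏1-q^ jaggedExponents (m +ℕ m) · 1ₛ ≈[ 2* m +1 ] ∏1-q^ evens m · ∏1-q^ odds m · ∏1-q^ odds m · 1ₛ
∏jaggedExponents-double m = begin
  ∏1-q^ jaggedExponents (m +ℕ m) · 1ₛ                                      ≈⟨ ≈⇒≈[] (∏1-q^-↭ (jaggedExponents-double m) 1ₛ) ⟩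
  ∏1-q^ evens m ++ odds m ++ odds m ++ oddsAbove m m · 1ₛ                   ≡⟨ trans (∏1-q^-++ (evens m) _ 1ₛ) (cong (∏1-q^ evens m ·_)
                                                                                 (trans (∏1-q^-++ (odds m) _ 1ₛ) (cong (∏1-q^ odds m ·_) (∏1-q^-++ (odds m) _ 1ₛ)))) ⟩
  ∏1-q^ evens m · ∏1-q^ odds m · ∏1-q^ odds m · ∏1-q^ oddsAbove m m · 1ₛ   ≈⟨ mul-causal P-mul (2* m +1) (∏1-q^-≈[]-id (oddsAbove m m) 1ₛ (oddsAbove-≥ m m)) ⟩
  ∏1-q^ evens m · ∏1-q^ odds m · ∏1-q^ odds m · 1ₛ                         ∎
  where
  open ≈[]-Reasoning (2* m +1)
  P-mul = ∘-isMultiplier (∏1-q^-isMultiplier (evens m))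
                         (∘-isMultiplier (∏1-q^-isMultiplier (odds m)) (∏1-q^-isMultiplier (odds m)))

θ·-inverse : ∀ m c → ∏1-q^ jaggedExponents (m +ℕ m) · c ≈ 1ₛ → θ· c ≈[ 2* m +1 ] 1ₛ
θ·-inverse m c inverse = ∏1-q^-cancel[] (jaggedExponents (m +ℕ m)) (jaggedExponents-positive (m +ℕ m)) (begin
  ∏1-q^ jaggedExponents (m +ℕ m) · θ· c     ≈⟨ ≈⇒≈[] (≈-sym (mul-∏1-q^-comm θ-isMultiplier (jaggedExponents (m +ℕ m)) c)) ⟩
  θ· ∏1-q^ jaggedExponents (m +ℕ m) · c     ≈⟨ ≈⇒≈[] (mul-cong θ-isMultiplier inverse) ⟩
  θ· 1ₛ                                     ≈⟨ ≈[]-sym (theta-truncation m) ⟩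
  ∏1-q^ evens m · ∏1-q^ odds m · ∏1-q^ odds m · 1ₛ ≈⟨ ≈[]-sym (∏jaggedExponents-double m) ⟩
  ∏1-q^ jaggedExponents (m +ℕ m) · 1ₛ       ∎)
  where open ≈[]-Reasoning (2* m +1)

jaggedExponents-suc : ∀ v → jaggedExponents (suc v) ↭ 2* v +1 ∷ suc v ∷ jaggedExponents v
jaggedExponents-suc v = ↭.trans (↭.prep (suc v) (↭.shift (2* v +1) (upto v) (odds v))) (↭.swap (suc v) (2* v +1) ↭.refl)

-- J v and K v are the generating functions of the jagged partitions whose first two parts
-- are bounded by (v, v) and (v, v + 1) respectively.
∏jaggedExponents-inverse : ∀ (J K : ℕ → Series) → J 0 ≈ 1ₛ →
  (∀ v → 1-q^ suc v · J (suc v) ≈ K v) → (∀ v → 1-q^ 2* v +1 · K v ≈ J v) →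
  ∀ v → ∏1-q^ jaggedExponents v · J v ≈ 1ₛ
∏jaggedExponents-inverse J K J₀ J-step K-step zero    = J₀
∏jaggedExponents-inverse J K J₀ J-step K-step (suc v) = begin
  ∏1-q^ jaggedExponents (suc v) · J (suc v)                          ≈⟨ ∏1-q^-↭ (jaggedExponents-suc v) (J (suc v)) ⟩
  1-q^ 2* v +1 · 1-q^ suc v · ∏1-q^ jaggedExponents v · J (suc v)    ≈⟨ mul-∏1-q^-comm F-mul (jaggedExponents v) (J (suc v)) ⟩
  ∏1-q^ jaggedExponents v · 1-q^ 2* v +1 · 1-q^ suc v · J (suc v)    ≈⟨ mul-cong (∏1-q^-isMultiplier (jaggedExponents v))
                                                                           (≈-trans (1-q^-cong (2* v +1) (J-step v)) (K-step v)) ⟩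
  ∏1-q^ jaggedExponents v · J v                                      ≈⟨ ∏jaggedExponents-inverse J K J₀ J-step K-step v ⟩
  1ₛ                                                                 ∎
  where
  open ≈-Reasoning
  F-mul = ∘-isMultiplier (1-q^-isMultiplier (2* v +1)) (1-q^-isMultiplier (suc v))

-- Coefficients of 1/θ modulo 64

odd-square even-square : ℕ → ℕ
odd-square  k = 2* k +1 *ℕ 2* k +1
even-square k = 2* k +2 *ℕ 2* k +2

k<odd-square : ∀ k → k < odd-square k
k<odd-square k = ℕ.<-≤-trans (s≤s (ℕ.m≤m+n k k)) (ℕ.m≤m*n (2* k +1) (2* k +1))

k<even-square : ∀ k → k < even-square k
k<even-square k = ℕ.<-≤-trans (s≤s (ℕ.m≤n⇒m≤1+n (ℕ.m≤m+n k k))) (ℕ.m≤m*n (2* k +2) (2* k +2))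

infixr 8 odd²·_ even²·_ ζ·_

-- ζ = ∑_k q^((2k+1)²) - ∑_k q^((2k+2)²) = -θ₊
odd²·_ even²·_ ζ·_ : Series → Series
odd²·  f = sparseMul (λ _ → 1ℤ) odd-square f
even²· f = sparseMul (λ _ → - 1ℤ) even-square f
ζ·     f = odd²· f ⊕ even²· f

odd²-isMultiplier : IsMultiplier odd²·_
odd²-isMultiplier = sparseMul-isMultiplier (λ _ → 1ℤ) odd-square k<odd-square

even²-isMultiplier : IsMultiplier even²·_
even²-isMultiplier = sparseMul-isMultiplier (λ _ → - 1ℤ) even-square k<even-square

ζ-isMultiplier : IsMultiplier ζ·_
ζ-isMultiplier = ⊕-isMultiplier odd²-isMultiplier even²-isMultiplier

θ₊-as-ζ : ∀ f → θ₊· f ≈ - 1ℤ ⊛ ζ· f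
θ₊-as-ζ f = mk≈ λ n → begin
  (θ₊· f) n                                                         ≡⟨ sparseMul-range (λ k → -1^ suc k) square+1 k<square+1 f n (n +ℕ n) (ℕ.m≤m+n n n) ⟩
  ∑< (n +ℕ n) (λ k → -1^ suc k * (q^ square+1 k · f) n)          ≡⟨ ∑<-even-odd n _ ⟩
  ∑< n (λ i → -1^ suc (i +ℕ i) * A n i + -1^ suc (suc (i +ℕ i)) * B n i)
                                                                  ≡⟨ ∑<-cong n (λ i → trans (cong₂ _+_ (odd-sign n i) (even-sign n i)) (negate (A n i) (B n i))) ⟩
  ∑< n (λ i → - (1ℤ * A n i + - 1ℤ * B n i))                      ≡⟨ ∑<-neg n _ ⟩
  - ∑< n (λ i → 1ℤ * A n i + - 1ℤ * B n i)                        ≡⟨ cong -_ (∑<-+ n (λ i → 1ℤ * A n i) (λ i → - 1ℤ * B n i)) ⟩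
  - ((odd²· f) n + (even²· f) n)                                      ≡⟨ sym (ℤ.-1*i≡-i _) ⟩
  - 1ℤ * (ζ· f) n                                                   ∎
  where
  open ≡-Reasoning
  A B : ℕ → ℕ → ℤ
  A n i = (q^ odd-square i · f) n
  B n i = (q^ even-square i · f) n
  odd-sign : ∀ n i → -1^ suc (i +ℕ i) * A n i ≡ - 1ℤ * A n i
  odd-sign n i = cong (λ s → - s * A n i) (-1^-double i)
  even-sign : ∀ n i → -1^ suc (suc (i +ℕ i)) * B n i ≡ 1ℤ * B n i
  even-sign n i = cong (_* B n i) (trans (ℤ.neg-involutive (-1^ (i +ℕ i))) (-1^-double i))
  negate : ∀ a b → - 1ℤ * a + 1ℤ * b ≡ - (1ℤ * a + - 1ℤ * b)
  negate = solve-∀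

θ·≈[]1ₛ⇒fixpoint : ∀ {B} c → θ· c ≈[ B ] 1ₛ → c ≈[ B ] 1ₛ ⊕ + 2 ⊛ ζ· c
θ·≈[]1ₛ⇒fixpoint c θc≈1 = mk≈[] (λ x x<B → begin
  c x                                           ≡⟨ solve-fixpoint (c x) ((ζ· c) x) ⟩
  (c x + + 2 * (- 1ℤ * (ζ· c) x)) + + 2 * (ζ· c) x  ≡⟨ cong (λ t → (c x + + 2 * t) + + 2 * (ζ· c) x) (sym (coeff (θ₊-as-ζ c) x)) ⟩
  (θ· c) x + + 2 * (ζ· c) x                         ≡⟨ cong (_+ + 2 * (ζ· c) x) (coeff< θc≈1 x x<B) ⟩
  1ₛ x + + 2 * (ζ· c) x                           ∎)
  where
  open ≡-Reasoning
  solve-fixpoint : ∀ a z → a ≡ (a + + 2 * (- 1ℤ * z)) + + 2 * z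
  solve-fixpoint = solve-∀

iterate-isMultiplier : ∀ {O} → IsMultiplier O → ∀ i → IsMultiplier (λ f → iterate O f i)
iterate-isMultiplier M zero    = id-isMultiplier
iterate-isMultiplier M (suc i) = ∘-isMultiplier (iterate-isMultiplier M i) M

fixpoint-expansion : ∀ {O} → IsMultiplier O → ∀ r {B} c → c ≈[ B ] 1ₛ ⊕ r ⊛ O c →
  ∀ k → c ≈[ B ] ∑ₛ< k (λ i → r ^ i ⊛ iterate O 1ₛ i) ⊕ r ^ k ⊛ iterate O c k
fixpoint-expansion M r c fix zero    = mk≈[] (λ x _ → sym (trans (ℤ.+-identityˡ _) (ℤ.*-identityˡ (c x))))
fixpoint-expansion {O} M r {B} c fix (suc k) = ≈[]-trans (fixpoint-expansion M r c fix k) (mk≈[] λ x x<B → begin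
  S x + r ^ k * Oᵏ c x                                        ≡⟨ cong (λ t → S x + r ^ k * t) (coeff< (mul-causal (iterate-isMultiplier M k) B fix) x x<B) ⟩
  S x + r ^ k * Oᵏ (1ₛ ⊕ r ⊛ O c) x                           ≡⟨ cong (λ t → S x + r ^ k * t) (coeff (mul-⊕ (iterate-isMultiplier M k) 1ₛ _) x) ⟩
  S x + r ^ k * (Oᵏ 1ₛ x + Oᵏ (r ⊛ O c) x)                    ≡⟨ cong (λ t → S x + r ^ k * (Oᵏ 1ₛ x + t)) (coeff (mul-⊛ (iterate-isMultiplier M k) r (O c)) x) ⟩
  S x + r ^ k * (Oᵏ 1ₛ x + r * Oᵏ (O c) x)                    ≡⟨ distribute (S x) (r ^ k) (Oᵏ 1ₛ x) r _ ⟩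
  (S x + r ^ k * Oᵏ 1ₛ x) + r * r ^ k * Oᵏ (O c) x            ≡⟨ cong (_+ r * r ^ k * Oᵏ (O c) x) (sym (∑<-snoc k (λ i → r ^ i * iterate O 1ₛ i x))) ⟩
  ∑ₛ< (suc k) (λ i → r ^ i ⊛ iterate O 1ₛ i) x + r * r ^ k * iterate O c (suc k) x ∎)
  where
  open ≡-Reasoning
  Oᵏ : Series → Series
  Oᵏ f = iterate O f k
  S = ∑ₛ< k (λ i → r ^ i ⊛ iterate O 1ₛ i)
  distribute : ∀ s p a r b → s + p * (a + r * b) ≡ (s + p * a) + r * p * b
  distribute = solve-∀

oddEven : ℕ → ℕ → Series
oddEven zero    zero    = 1ₛ
oddEven zero    (suc b) = even²· oddEven zero b
oddEven (suc a) b       = odd²· oddEven a b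

even²-oddEven : ∀ a b → even²· oddEven a b ≈ oddEven a (suc b)
even²-oddEven zero    b = ≈-refl
even²-oddEven (suc a) b =
  ≈-trans (sparseMul-comm (λ _ → - 1ℤ) even-square (λ _ → 1ℤ) odd-square k<even-square k<odd-square (oddEven a b))
          (mul-cong odd²-isMultiplier (even²-oddEven a b))

-- ζ^i expands into a sum over the 2^i words in odd² and even²; as these commute, only the
-- numbers a, b of letters of each kind matter.
walks : (ℕ → ℕ → ℤ) → ℕ → ℕ → ℕ → ℤ
walks h zero    a b = h a b
walks h (suc i) a b = walks h i (suc a) b + walks h i a (suc b)

ζ^-oddEven : ∀ i a b x → iterate ζ·_ (oddEven a b) i x ≡ walks (λ a′ b′ → oddEven a′ b′ x) i a b
ζ^-oddEven zero    a b x = refl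
ζ^-oddEven (suc i) a b x = begin
  ζⁱ (oddEven (suc a) b ⊕ even²· oddEven a b) x        ≡⟨ coeff (mul-cong Mⁱ (⊕-congʳ (oddEven (suc a) b) (even²-oddEven a b))) x ⟩
  ζⁱ (oddEven (suc a) b ⊕ oddEven a (suc b)) x         ≡⟨ coeff (mul-⊕ Mⁱ (oddEven (suc a) b) (oddEven a (suc b))) x ⟩
  ζⁱ (oddEven (suc a) b) x + ζⁱ (oddEven a (suc b)) x  ≡⟨ cong₂ _+_ (ζ^-oddEven i (suc a) b x) (ζ^-oddEven i a (suc b) x) ⟩
  walks (λ a′ b′ → oddEven a′ b′ x) (suc i) a b        ∎
  where
  open ≡-Reasoning
  ζⁱ : Series → Series
  ζⁱ f = iterate ζ·_ f i
  Mⁱ = iterate-isMultiplier ζ-isMultiplier i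

walks-cong : ∀ i a b (h h′ : ℕ → ℕ → ℤ) → (∀ a′ b′ → a′ +ℕ b′ ≡ i +ℕ (a +ℕ b) → h a′ b′ ≡ h′ a′ b′) →
             walks h i a b ≡ walks h′ i a b
walks-cong zero    a b h h′ h≡h′ = h≡h′ a b refl
walks-cong (suc i) a b h h′ h≡h′ =
  cong₂ _+_ (walks-cong i (suc a) b h h′ (λ a′ b′ e → h≡h′ a′ b′ (trans e (ℕ.+-suc i (a +ℕ b)))))
            (walks-cong i a (suc b) h h′ (λ a′ b′ e → h≡h′ a′ b′ (trans e (trans (cong (i +ℕ_) (ℕ.+-suc a b)) (ℕ.+-suc i (a +ℕ b))))))

-- the number of walks of length i from a that end at 3, i.e. the binomial coefficient (i choose 3 - a)
walksTo3 : ℕ → ℕ → ℕ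
walksTo3 zero    3 = 1
walksTo3 zero    _ = 0
walksTo3 (suc i) a = walksTo3 i (suc a) +ℕ walksTo3 i a

select3 : ℤ → ℕ → ℕ → ℤ
select3 y 3 b = y
select3 y _ b = 0ℤ

walks-select3 : ∀ y i a b → walks (select3 y) i a b ≡ + walksTo3 i a * y
walks-select3 y zero    3                             b = sym (ℤ.*-identityˡ y)
walks-select3 y zero    0                             b = sym (ℤ.*-zeroˡ y)
walks-select3 y zero    1                             b = sym (ℤ.*-zeroˡ y)
walks-select3 y zero    2                             b = sym (ℤ.*-zeroˡ y)
walks-select3 y zero    (suc (suc (suc (suc a))))     b = sym (ℤ.*-zeroˡ y)
walks-select3 y (suc i) a b = begin
  walks (select3 y) i (suc a) b + walks (select3 y) i a (suc b)  ≡⟨ cong₂ _+_ (walks-select3 y i (suc a) b) (walks-select3 y i a (suc b)) ⟩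
  + walksTo3 i (suc a) * y + + walksTo3 i a * y                  ≡⟨ sym (ℤ.*-distribʳ-+ y (+ walksTo3 i (suc a)) (+ walksTo3 i a)) ⟩
  (+ walksTo3 i (suc a) + + walksTo3 i a) * y                    ≡⟨ cong (_* y) (ℤ.pos-+ (walksTo3 i (suc a)) (walksTo3 i a)) ⟩
  + walksTo3 (suc i) a * y                                       ∎
  where open ≡-Reasoning

SupportedMod : (d : ℕ) .{{_ : NonZero d}} → ℕ → Series → Set
SupportedMod d r f = ∀ n → ¬ (n % d ≡ r) → f n ≡ 0ℤ

1ₛ-supported : ∀ d .{{_ : NonZero d}} → SupportedMod d 0 1ₛ
1ₛ-supported d zero    0%d≢0 = ⊥-elim (0%d≢0 (m*n%n≡0 0 d))
1ₛ-supported d (suc n) _     = refl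

sparseMul-supported : ∀ d .{{_ : NonZero d}} w s e r f → (∀ k → s k % d ≡ e) →
                      SupportedMod d r f → SupportedMod d ((r +ℕ e) % d) (sparseMul w s f)
sparseMul-supported d w s e r f s%d f-supported n n≢ = ∑<-zero n _ term
  where
  term : ∀ k → k < n → w k * (q^ s k · f) n ≡ 0ℤ
  term k _ with s k ≤? n
  ... | no sk≰n  = trans (cong (w k *_) (q^-below (s k) f n (ℕ.≰⇒> sk≰n))) (ℤ.*-zeroʳ (w k))
  ... | yes sk≤n = trans (cong (w k *_) (trans (q^-at (s k) f n sk≤n) (f-supported (n ∸ s k) off-residue))) (ℤ.*-zeroʳ (w k))
    where
    off-residue : ¬ ((n ∸ s k) % d ≡ r)
    off-residue eq = n≢ (begin
      n % d                           ≡⟨ cong (_% d) (sym (ℕ.m∸n+n≡m sk≤n)) ⟩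
      (n ∸ s k +ℕ s k) % d            ≡⟨ %-distribˡ-+ (n ∸ s k) (s k) d ⟩
      ((n ∸ s k) % d +ℕ s k % d) % d  ≡⟨ cong₂ (λ u v → (u +ℕ v) % d) eq (s%d k) ⟩
      (r +ℕ e) % d                    ∎)
      where open ≡-Reasoning

odd-square%4 : ∀ k → odd-square k % 4 ≡ 1
odd-square%4 k = trans (cong (_% 4) (expand k)) ([m+kn]%n≡m%n 1 (k *ℕ k +ℕ k) 4)
  where
  expand : ∀ k → suc (k +ℕ k) *ℕ suc (k +ℕ k) ≡ 1 +ℕ (k *ℕ k +ℕ k) *ℕ 4
  expand = ℕ-solve-∀

odd-square%8 : ∀ k → odd-square k % 8 ≡ 1
odd-square%8 zero    = refl
odd-square%8 (suc k) = trans (cong (_% 8) (expand k)) (trans ([m+kn]%n≡m%n (odd-square k) (suc k) 8) (odd-square%8 k))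
  where
  expand : ∀ k → suc (suc k +ℕ suc k) *ℕ suc (suc k +ℕ suc k) ≡ suc (k +ℕ k) *ℕ suc (k +ℕ k) +ℕ suc k *ℕ 8
  expand = ℕ-solve-∀

even-square%4 : ∀ k → even-square k % 4 ≡ 0
even-square%4 k = trans (cong (_% 4) (expand k)) (m*n%n≡0 (suc k *ℕ suc k) 4)
  where
  expand : ∀ k → suc (suc (k +ℕ k)) *ℕ suc (suc (k +ℕ k)) ≡ (suc k *ℕ suc k) *ℕ 4
  expand = ℕ-solve-∀

oddEven-supported : ∀ a b → SupportedMod 4 (a % 4) (oddEven a b)
oddEven-supported zero    zero    = 1ₛ-supported 4
oddEven-supported zero    (suc b) =
  sparseMul-supported 4 (λ _ → - 1ℤ) even-square 0 0 (oddEven 0 b) even-square%4 (oddEven-supported 0 b)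
oddEven-supported (suc a) b n n≢ =
  sparseMul-supported 4 (λ _ → 1ℤ) odd-square 1 (a % 4) (oddEven a b) odd-square%4 (oddEven-supported a b) n
    (λ eq → n≢ (trans eq (trans (sym (%-distribˡ-+ a 1 4)) (cong (_% 4) (ℕ.+-comm a 1)))))

oddEven-3-0-supported : SupportedMod 8 3 (oddEven 3 0)
oddEven-3-0-supported =
  sparseMul-supported 8 (λ _ → 1ℤ) odd-square 1 2 (oddEven 2 0) odd-square%8
    (sparseMul-supported 8 (λ _ → 1ℤ) odd-square 1 1 (oddEven 1 0) odd-square%8
      (sparseMul-supported 8 (λ _ → 1ℤ) odd-square 1 0 (oddEven 0 0) odd-square%8 (1ₛ-supported 8)))

module Residue7Mod8 (n : ℕ) where

  N : ℕ
  N = 8 *ℕ n +ℕ 7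

  N%4≡3 : N % 4 ≡ 3
  N%4≡3 = trans (cong (_% 4) (expand n)) ([m+kn]%n≡m%n 7 (n +ℕ n) 4)
    where
    expand : ∀ n → 8 *ℕ n +ℕ 7 ≡ 7 +ℕ (n +ℕ n) *ℕ 4
    expand = ℕ-solve-∀

  N%8≡7 : N % 8 ≡ 7
  N%8≡7 = trans (cong (_% 8) (expand n)) ([m+kn]%n≡m%n 7 n 8)
    where
    expand : ∀ n → 8 *ℕ n +ℕ 7 ≡ 7 +ℕ n *ℕ 8
    expand = ℕ-solve-∀

  oddEven-vanishes : ∀ a b → a ≤ 5 → ¬ (a ≡ 3) → oddEven a b N ≡ 0ℤ
  oddEven-vanishes a b a≤5 a≢3 = oddEven-supported a b N (λ eq → residue a a≤5 a≢3 (trans (sym N%4≡3) eq))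
    where
    residue : ∀ a → a ≤ 5 → ¬ (a ≡ 3) → ¬ (3 ≡ a % 4)
    residue 0 _ _ ()
    residue 1 _ _ ()
    residue 2 _ _ ()
    residue 3 _ a≢3 _ = a≢3 refl
    residue 4 _ _ ()
    residue 5 _ _ ()
    residue (suc (suc (suc (suc (suc (suc a)))))) (s≤s (s≤s (s≤s (s≤s (s≤s ()))))) _ _

  oddEven-3-0-vanishes : oddEven 3 0 N ≡ 0ℤ
  oddEven-3-0-vanishes = oddEven-3-0-supported N (λ eq → 7≢3 (trans (sym N%8≡7) eq))
    where
    7≢3 : ¬ (7 ≡ 3)
    7≢3 ()

  -- For i ≤ 5 only the words with exactly three letters odd² contribute at degree N ≡ 3 (mod 4).
  ζ^-at-N : ∀ i y → i ≤ 5 → (∀ b → 3 +ℕ b ≡ i → oddEven 3 b N ≡ y) → iterate ζ·_ 1ₛ i N ≡ + walksTo3 i 0 * y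
  ζ^-at-N i y i≤5 only-3 = begin
    iterate ζ·_ (oddEven 0 0) i N                  ≡⟨ ζ^-oddEven i 0 0 N ⟩
    walks (λ a b → oddEven a b N) i 0 0            ≡⟨ walks-cong i 0 0 _ (select3 y) select ⟩
    walks (select3 y) i 0 0                        ≡⟨ walks-select3 y i 0 0 ⟩
    + walksTo3 i 0 * y                             ∎
    where
    open ≡-Reasoning
    select : ∀ a b → a +ℕ b ≡ i +ℕ 0 → oddEven a b N ≡ select3 y a b
    select 3 b e = only-3 b (trans e (ℕ.+-identityʳ i))
    select 0 b e = oddEven-vanishes 0 b z≤n (λ ())
    select 1 b e = oddEven-vanishes 1 b (s≤s z≤n) (λ ())
    select 2 b e = oddEven-vanishes 2 b (s≤s (s≤s z≤n)) (λ ())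
    select a@(suc (suc (suc (suc _)))) b e =
      oddEven-vanishes a b (ℕ.≤-trans (ℕ.m≤m+n a b) (ℕ.≤-trans (ℕ.≤-reflexive (trans e (ℕ.+-identityʳ i))) i≤5)) (λ ())

  -- c = ∑_{i<6} 2^i ζ^i + 2^6 ζ^6 c, and at degree N the terms i < 4 vanish while the
  -- terms i = 4, 5 are 2^4 · 4 and 2^5 · 10 times a coefficient.
  64∣coefficient : ∀ B c → θ· c ≈[ B ] 1ₛ → N < B → Σ ℤ (λ z → c N ≡ + 64 * z)
  64∣coefficient B c θc≈1 N<B = y₄ + + 5 * y₅ + iterate ζ·_ c 6 N , (begin
    c N                                                      ≡⟨ coeff< (fixpoint-expansion ζ-isMultiplier (+ 2) c (θ·≈[]1ₛ⇒fixpoint c θc≈1) 6) N N<B ⟩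
    ∑< 6 (λ i → (+ 2) ^ i * ζ^ i) + (+ 2) ^ 6 * iterate ζ·_ c 6 N ≡⟨ cong (_+ (+ 2) ^ 6 * iterate ζ·_ c 6 N) low-terms ⟩
    ∑< 6 (λ i → (+ 2) ^ i * v i) + (+ 2) ^ 6 * iterate ζ·_ c 6 N  ≡⟨ collect y₄ y₅ (iterate ζ·_ c 6 N) ⟩
    + 64 * (y₄ + + 5 * y₅ + iterate ζ·_ c 6 N)               ∎)
    where
    open ≡-Reasoning
    ζ^ : ℕ → ℤ
    ζ^ i = iterate ζ·_ 1ₛ i N
    y₄ = oddEven 3 1 N
    y₅ = oddEven 3 2 N
    v′ : ℤ → ℤ → ℕ → ℤ
    v′ u w 4 = + 4 * u
    v′ u w 5 = + 10 * w
    v′ u w 3 = + 1 * 0ℤ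
    v′ u w _ = + 0 * 0ℤ
    v = v′ y₄ y₅
    low-terms : ∑< 6 (λ i → (+ 2) ^ i * ζ^ i) ≡ ∑< 6 (λ i → (+ 2) ^ i * v i)
    low-terms = ∑<-cong-< 6 (λ i i<6 → cong ((+ 2) ^ i *_) (term i i<6))
      where
      term : ∀ i → i < 6 → ζ^ i ≡ v i
      term 0 _ = ζ^-at-N 0 0ℤ z≤n (λ _ ())
      term 1 _ = ζ^-at-N 1 0ℤ (s≤s z≤n) (λ _ ())
      term 2 _ = ζ^-at-N 2 0ℤ (s≤s (s≤s z≤n)) (λ _ ())
      term 3 _ = ζ^-at-N 3 0ℤ (s≤s (s≤s (s≤s z≤n))) (λ { zero refl → oddEven-3-0-vanishes })
      term 4 _ = ζ^-at-N 4 y₄ (s≤s (s≤s (s≤s (s≤s z≤n)))) (λ { 1 refl → refl })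
      term 5 _ = ζ^-at-N 5 y₅ (s≤s (s≤s (s≤s (s≤s (s≤s z≤n))))) (λ { 2 refl → refl })
      term (suc (suc (suc (suc (suc (suc _)))))) (s≤s (s≤s (s≤s (s≤s (s≤s (s≤s ()))))))
    collect : ∀ u w r →
      ((+ 2) ^ 0 * (+ 0 * 0ℤ) + ((+ 2) ^ 1 * (+ 0 * 0ℤ) + ((+ 2) ^ 2 * (+ 0 * 0ℤ) + ((+ 2) ^ 3 * (+ 1 * 0ℤ)
        + ((+ 2) ^ 4 * (+ 4 * u) + ((+ 2) ^ 5 * (+ 10 * w) + 0ℤ)))))) + (+ 2) ^ 6 * r ≡ + 64 * (u + + 5 * w + r)
    collect = solve-∀

-- Counting bounded jagged partitions

shiftℕ : ℕ → (ℕ → ℕ) → ℕ → ℕ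
shiftℕ zero    h N       = h N
shiftℕ (suc s) h zero    = 0
shiftℕ (suc s) h (suc N) = shiftℕ s h N

shiftℕ-ext : ∀ s h h′ N → (∀ n → s +ℕ n ≡ N → h n ≡ h′ n) → shiftℕ s h N ≡ shiftℕ s h′ N
shiftℕ-ext zero    h h′ N       h≡h′ = h≡h′ N refl
shiftℕ-ext (suc s) h h′ zero    h≡h′ = refl
shiftℕ-ext (suc s) h h′ (suc N) h≡h′ = shiftℕ-ext s h h′ N (λ n e → h≡h′ n (cong suc e))

q^-shiftℕ : ∀ s h N → (q^ s · (λ n → + h n)) N ≡ + shiftℕ s h N
q^-shiftℕ zero    h N       = refl
q^-shiftℕ (suc s) h zero    = refl
q^-shiftℕ (suc s) h (suc N) = q^-shiftℕ s h N

-- geometric s g = g / (1 - q^s), computed with enough fuel.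
geometricFuel : ℕ → (ℕ → ℕ) → ℕ → ℕ → ℕ
geometricFuel s g zero       N = g N
geometricFuel s g (suc fuel) N = g N +ℕ shiftℕ s (geometricFuel s g fuel) N

geometric : ℕ → (ℕ → ℕ) → ℕ → ℕ
geometric s g N = geometricFuel s g N N

geometricFuel-enough : ∀ s g → 1 ≤ s → ∀ f f′ N → N ≤ f → N ≤ f′ → geometricFuel s g f N ≡ geometricFuel s g f′ N
geometricFuel-enough s       g s≥1 zero    zero     N       _   _    = refl
geometricFuel-enough (suc s) g s≥1 zero    (suc f′) zero    _   _    = sym (ℕ.+-identityʳ (g 0))
geometricFuel-enough (suc s) g s≥1 (suc f) zero     zero    _   _    = ℕ.+-identityʳ (g 0)
geometricFuel-enough s       g s≥1 (suc f) (suc f′) N       N≤f N≤f′ =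
  cong (g N +ℕ_) (shiftℕ-ext s _ _ N (λ n e → geometricFuel-enough s g s≥1 f f′ n (below e N≤f) (below e N≤f′)))
  where
  below : ∀ {n F} → s +ℕ n ≡ N → N ≤ suc F → n ≤ F
  below {n} e N≤ = ℕ.≤-pred (ℕ.≤-trans (ℕ.+-monoˡ-≤ n s≥1) (ℕ.≤-trans (ℕ.≤-reflexive e) N≤))

geometric-rec : ∀ s g → 1 ≤ s → ∀ N → geometric s g N ≡ g N +ℕ shiftℕ s (geometric s g) N
geometric-rec (suc s) g s≥1 zero    = sym (ℕ.+-identityʳ (g 0))
geometric-rec s       g s≥1 (suc N) =
  cong (g (suc N) +ℕ_) (shiftℕ-ext s _ _ (suc N) (λ n e → geometricFuel-enough s g s≥1 N n n (below e) ℕ.≤-refl))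
  where
  below : ∀ {n} → s +ℕ n ≡ suc N → n ≤ N
  below {n} e = ℕ.≤-pred (ℕ.≤-trans (ℕ.+-monoˡ-≤ n s≥1) (ℕ.≤-reflexive e))

1-q^-geometric : ∀ s g → 1 ≤ s → 1-q^ s · (λ N → + geometric s g N) ≈ (λ N → + g N)
1-q^-geometric s g s≥1 = mk≈ at
  where
  cancel : ∀ a b → (a + b) - b ≡ a
  cancel = solve-∀
  at : ∀ N → (1-q^ s · (λ n → + geometric s g n)) N ≡ + g N
  at N = begin
    + geometric s g N - (q^ s · (λ n → + geometric s g n)) N  ≡⟨ cong₂ _-_ (cong +_ (geometric-rec s g s≥1 N)) (q^-shiftℕ s (geometric s g) N) ⟩
    + (g N +ℕ G) - + G                                        ≡⟨ cong (_- + G) (ℤ.pos-+ (g N) G) ⟩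
    (+ g N + + G) - + G                                       ≡⟨ cancel (+ g N) (+ G) ⟩
    + g N                                                     ∎
    where
    open ≡-Reasoning
    G = shiftℕ s (geometric s g) N

Fin-shiftℕ↔ : ∀ s h N → Fin (shiftℕ s h N) ↔ Σ ℕ (λ n → s +ℕ n ≡ N × Fin (h n))
Fin-shiftℕ↔ zero    h N       = mk↔ₛ′ (λ i → N , refl , i) (λ { (n , refl , i) → i })
                                      (λ { (n , refl , i) → refl }) (λ i → refl)
Fin-shiftℕ↔ (suc s) h zero    = mk↔ₛ′ (λ ()) (λ { (n , () , i) }) (λ { (n , () , i) }) (λ ())
Fin-shiftℕ↔ (suc s) h (suc N) = ↔-trans (Fin-shiftℕ↔ s h N) (mk↔ₛ′
  (λ { (n , e , i) → n , cong suc e , i }) (λ { (n , e , i) → n , ℕ.suc-injective e , i })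
  (λ { (n , e , i) → cong (λ z → n , z , i) (ℕ.≡-irrelevant _ _) })
  (λ { (n , e , i) → cong (λ z → n , z , i) (ℕ.≡-irrelevant _ _) }))

Fin-geometric↔ : ∀ s (g : ℕ → ℕ) (A B : ℕ → Set) → 1 ≤ s → (∀ N → Fin (g N) ↔ A N) →
                 (∀ N → B N ↔ (A N ⊎ Σ ℕ (λ n → s +ℕ n ≡ N × B n))) → ∀ N → Fin (geometric s g N) ↔ B N
Fin-geometric↔ s g A B s≥1 Fin↔A split = <-rec (λ N → Fin (geometric s g N) ↔ B N) step
  where
  step : ∀ N → (∀ {n} → n < N → Fin (geometric s g n) ↔ B n) → Fin (geometric s g N) ↔ B N
  step N IH =
    ↔-trans (Fin-≡ (geometric-rec s g s≥1 N))
    (↔-trans Fin.+↔⊎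
    (↔-trans (Fin↔A N ⊎-↔ ↔-trans (Fin-shiftℕ↔ s (geometric s g) N) (Σ-↔ ↔-refl (Σ-↔ ↔-refl (λ {e} → IH (smaller e)))))
             (↔-sym (split N))))
    where
    Fin-≡ : ∀ {a b} → a ≡ b → Fin a ↔ Fin b
    Fin-≡ refl = ↔-refl
    smaller : ∀ {n} → s +ℕ n ≡ N → n < N
    smaller {n} e = ℕ.≤-trans (ℕ.+-monoˡ-≤ n s≥1) (ℕ.≤-reflexive e)

first second : List ℕ → ℕ
first  []      = 0
first  (x ∷ _) = x
second []          = 0
second (_ ∷ [])    = 0
second (_ ∷ y ∷ _) = y

second-∷ : ∀ x xs → second (x ∷ xs) ≡ first xs
second-∷ x []      = refl
second-∷ x (y ∷ _) = refl

first≤sum : ∀ xs → first xs ≤ sum xs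
first≤sum []      = z≤n
first≤sum (x ∷ r) = ℕ.m≤m+n x (sum r)

second≤sum : ∀ xs → second xs ≤ sum xs
second≤sum []          = z≤n
second≤sum (x ∷ [])    = z≤n
second≤sum (x ∷ y ∷ r) = ℕ.≤-trans (ℕ.m≤m+n y (sum r)) (ℕ.m≤n+m (y +ℕ sum r) x)

Jagged-irrelevant : ∀ xs (p q : Jagged xs) → p ≡ q
Jagged-irrelevant []              tt        tt        = refl
Jagged-irrelevant (a ∷ [])        p         q         = ℕ.≤-irrelevant p q
Jagged-irrelevant (a ∷ b ∷ [])    (p₁ , p₂) (q₁ , q₂) = cong₂ _,_ (ℕ.≤-irrelevant p₁ q₁) (ℕ.≤-irrelevant p₂ q₂)
Jagged-irrelevant (a ∷ b ∷ c ∷ r) (p₁ , p₂ , p₃) (q₁ , q₂ , q₃) =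
  cong₂ _,_ (ℕ.≤-irrelevant p₁ q₁) (cong₂ _,_ (ℕ.≤-irrelevant p₂ q₂) (Jagged-irrelevant (b ∷ c ∷ r) p₃ q₃))

Jagged-tail : ∀ x xs → Jagged (x ∷ xs) → Jagged xs
Jagged-tail x []          _           = tt
Jagged-tail x (b ∷ [])    (_ , p)     = p
Jagged-tail x (b ∷ c ∷ r) (_ , _ , p) = p

Jagged-∷ : ∀ x xs → Jagged xs → 1 ≤ x → first xs ≤ suc x → second xs ≤ x → Jagged (x ∷ xs)
Jagged-∷ x []          _  x≥1 _ _ = x≥1
Jagged-∷ x (b ∷ [])    jb _   h _ = h , jb
Jagged-∷ x (b ∷ c ∷ r) j  _   h s = h , s , j

Jagged-∷∷ : ∀ x y ys → Jagged (y ∷ ys) → y ≤ suc x → first ys ≤ x → Jagged (x ∷ y ∷ ys)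
Jagged-∷∷ x y []      j h _ = h , j
Jagged-∷∷ x y (c ∷ r) j h s = h , s , j

Jagged-third : ∀ x xs → Jagged (x ∷ xs) → second xs ≤ x
Jagged-third x []          _           = z≤n
Jagged-third x (y ∷ [])    _           = z≤n
Jagged-third x (y ∷ z ∷ r) (_ , p , _) = p

Jagged-step : ∀ x y xs → Jagged (x ∷ y ∷ xs) → y ≤ suc x
Jagged-step x y []      (p , _) = p
Jagged-step x y (c ∷ r) (p , _) = p

IsBounded : ℕ → ℕ → ℕ → List ℕ → Set
IsBounded a b N xs = Jagged xs × sum xs ≡ N × first xs ≤ a × second xs ≤ b

Bounded : ℕ → ℕ → ℕ → Set
Bounded a b N = Σ (List ℕ) (IsBounded a b N)

Bounded-≡ : ∀ {a b N} xs (p q : IsBounded a b N xs) → _≡_ {A = Bounded a b N} (xs , p) (xs , q)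
Bounded-≡ xs (p₁ , p₂ , p₃ , p₄) (q₁ , q₂ , q₃ , q₄) = cong (xs ,_)
  (cong₂ _,_ (Jagged-irrelevant xs p₁ q₁) (cong₂ _,_ (ℕ.≡-irrelevant p₂ q₂) (cong₂ _,_ (ℕ.≤-irrelevant p₃ q₃) (ℕ.≤-irrelevant p₄ q₄))))

JBounded KBounded : ℕ → ℕ → Set
JBounded m = Bounded m m
KBounded m = Bounded m (suc m)

JBounded-split : ∀ m N → JBounded (suc m) N ↔ (KBounded m N ⊎ Σ ℕ (λ n → suc m +ℕ n ≡ N × JBounded (suc m) n))
JBounded-split m N = mk↔ₛ′ to from to∘from from∘to
  where
  B = KBounded m N ⊎ Σ ℕ (λ n → suc m +ℕ n ≡ N × JBounded (suc m) n)

  to-∷ : ∀ x rest → Jagged (x ∷ rest) → x +ℕ sum rest ≡ N → x ≤ suc m → second (x ∷ rest) ≤ suc m → Dec (x ≡ suc m) → B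
  to-∷ x rest j e h s (yes refl) =
    inj₂ (sum rest , e , rest , Jagged-tail x rest j , refl , subst (_≤ suc m) (second-∷ x rest) s , Jagged-third x rest j)
  to-∷ x rest j e h s (no x≢) = inj₁ (x ∷ rest , j , e , ℕ.≤-pred (ℕ.≤∧≢⇒< h x≢) , s)

  to : JBounded (suc m) N → B
  to ([]       , j , e , h , s) = inj₁ ([] , j , e , z≤n , z≤n)
  to (x ∷ rest , j , e , h , s) = to-∷ x rest j e h s (x ≟ suc m)

  from : B → JBounded (suc m) N
  from (inj₁ (xs , j , e , h , s)) = xs , j , e , ℕ.m≤n⇒m≤1+n h , s
  from (inj₂ (n , e , rest , j , refl , h , s)) =
    suc m ∷ rest , Jagged-∷ (suc m) rest j (s≤s z≤n) (ℕ.m≤n⇒m≤1+n h) s , e , ℕ.≤-refl ,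
    subst (_≤ suc m) (sym (second-∷ (suc m) rest)) h

  from∘to : ∀ p → from (to p) ≡ p
  from∘to ([] , p) = Bounded-≡ [] _ p
  from∘to (x ∷ rest , j , e , h , s) with x ≟ suc m
  ... | yes refl = Bounded-≡ (x ∷ rest) _ (j , e , h , s)
  ... | no  _    = Bounded-≡ (x ∷ rest) _ (j , e , h , s)

  to∘from : ∀ q → to (from q) ≡ q
  to∘from (inj₁ ([] , j , e , h , s)) = cong inj₁ (Bounded-≡ [] _ (j , e , h , s))
  to∘from (inj₁ (x ∷ rest , j , e , h , s)) with x ≟ suc m
  ... | yes refl = ⊥-elim (ℕ.<-irrefl refl h)
  ... | no  _    = cong inj₁ (Bounded-≡ (x ∷ rest) _ (j , e , h , s))
  to∘from (inj₂ (n , e , rest , j , refl , h , s)) with suc m ≟ suc m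
  ... | yes refl = cong inj₂ (cong₂ (λ p q → sum rest , p , q) (ℕ.≡-irrelevant _ _) (Bounded-≡ rest _ (j , refl , h , s)))
  ... | no  m≢m  = ⊥-elim (m≢m refl)

-- Split off leading parts m, m+1: a second part m+1 forces the first to be m.
KBounded-split : ∀ m N → KBounded m N ↔ (JBounded m N ⊎ Σ ℕ (λ n → 2* m +1 +ℕ n ≡ N × KBounded m n))
KBounded-split m N = mk↔ₛ′ to from to∘from from∘to
  where
  B = JBounded m N ⊎ Σ ℕ (λ n → 2* m +1 +ℕ n ≡ N × KBounded m n)

  regroup : ∀ m r → m +ℕ (suc m +ℕ r) ≡ suc (m +ℕ m) +ℕ r
  regroup = ℕ-solve-∀

  forced : ∀ x rest → Jagged (x ∷ suc m ∷ rest) → x ≤ m → x ≡ m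
  forced x rest j h = ℕ.≤-antisym h (ℕ.≤-pred (Jagged-step x (suc m) rest j))

  to-∷∷ : ∀ x y rest → Jagged (x ∷ y ∷ rest) → x +ℕ (y +ℕ sum rest) ≡ N → x ≤ m → y ≤ suc m → Dec (y ≡ suc m) → B
  to-∷∷ x y rest j e h s (yes refl) =
    inj₂ (sum rest , trans (sym (regroup m (sum rest))) (subst (λ z → z +ℕ (suc m +ℕ sum rest) ≡ N) (forced x rest j h) e) ,
          rest , Jagged-tail y rest (Jagged-tail x (y ∷ rest) j) , refl ,
          ℕ.≤-trans (subst (_≤ x) (second-∷ y rest) (Jagged-third x (y ∷ rest) j)) h ,
          Jagged-third y rest (Jagged-tail x (y ∷ rest) j))
  to-∷∷ x y rest j e h s (no y≢) = inj₁ (x ∷ y ∷ rest , j , e , h , ℕ.≤-pred (ℕ.≤∧≢⇒< s y≢))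

  to : KBounded m N → B
  to ([]           , j , e , h , s) = inj₁ ([] , j , e , z≤n , z≤n)
  to (x ∷ []       , j , e , h , s) = inj₁ (x ∷ [] , j , e , h , z≤n)
  to (x ∷ y ∷ rest , j , e , h , s) = to-∷∷ x y rest j e h s (y ≟ suc m)

  from : B → KBounded m N
  from (inj₁ (xs , j , e , h , s)) = xs , j , e , h , ℕ.m≤n⇒m≤1+n s
  from (inj₂ (n , e , rest , j , refl , h , s)) =
    m ∷ suc m ∷ rest ,
    Jagged-∷∷ m (suc m) rest (Jagged-∷ (suc m) rest j (s≤s z≤n) (ℕ.m≤n⇒m≤1+n (ℕ.m≤n⇒m≤1+n h)) s) ℕ.≤-refl h ,
    trans (regroup m (sum rest)) e , ℕ.≤-refl , ℕ.≤-refl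

  from∘to : ∀ p → from (to p) ≡ p
  from∘to ([] , p)     = Bounded-≡ [] _ p
  from∘to (x ∷ [] , p) = Bounded-≡ (x ∷ []) _ p
  from∘to (x ∷ y ∷ rest , j , e , h , s) with y ≟ suc m
  ... | no _     = Bounded-≡ (x ∷ y ∷ rest) _ (j , e , h , s)
  ... | yes refl with forced x rest j h
  ...   | refl = Bounded-≡ (x ∷ y ∷ rest) _ (j , e , h , s)

  to∘from : ∀ q → to (from q) ≡ q
  to∘from (inj₁ ([] , j , e , h , s))     = cong inj₁ (Bounded-≡ [] _ (j , e , h , s))
  to∘from (inj₁ (x ∷ [] , j , e , h , s)) = cong inj₁ (Bounded-≡ (x ∷ []) _ (j , e , h , s))
  to∘from (inj₁ (x ∷ y ∷ rest , j , e , h , s)) with y ≟ suc m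
  ... | yes refl = ⊥-elim (ℕ.<-irrefl refl s)
  ... | no _     = cong inj₁ (Bounded-≡ (x ∷ y ∷ rest) _ (j , e , h , s))
  to∘from (inj₂ (n , e , rest , j , refl , h , s)) with suc m ≟ suc m
  ... | yes refl = cong inj₂ (cong₂ (λ p q → sum rest , p , q) (ℕ.≡-irrelevant _ _) (Bounded-≡ rest _ (j , refl , h , s)))
  ... | no m≢m   = ⊥-elim (m≢m refl)

Bounded-0 : ∀ xs → Jagged xs → first xs ≤ 0 → second xs ≤ 0 → xs ≡ []
Bounded-0 []          _ _   _   = refl
Bounded-0 (x ∷ [])    () z≤n _
Bounded-0 (x ∷ y ∷ r) j z≤n z≤n = ⊥-elim (no-00 r j)
  where
  no-00 : ∀ r → Jagged (0 ∷ 0 ∷ r) → ⊥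
  no-00 []      (_ , ())
  no-00 (c ∷ r) (_ , z≤n , j) = no-00 r j

isZero : ℕ → ℕ
isZero zero    = 1
isZero (suc _) = 0

Fin-isZero↔JBounded0 : ∀ N → Fin (isZero N) ↔ JBounded 0 N
Fin-isZero↔JBounded0 zero = mk↔ₛ′ (λ _ → empty) (λ _ → Fin.zero) unique (λ { Fin.zero → refl ; (Fin.suc ()) })
  where
  empty : JBounded 0 0
  empty = [] , tt , refl , z≤n , z≤n
  unique : ∀ p → empty ≡ p
  unique (xs , j , e , h , s) with Bounded-0 xs j h s
  ... | refl = Bounded-≡ [] _ (j , e , h , s)
Fin-isZero↔JBounded0 (suc N) = mk↔ₛ′ (λ ()) none (λ p → ⊥-elim (Fin0-empty (none p))) (λ ())
  where
  Fin0-empty : Fin 0 → ⊥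
  Fin0-empty ()
  none : JBounded 0 (suc N) → Fin 0
  none (xs , j , e , h , s) with Bounded-0 xs j h s
  none (.[] , j , () , h , s) | refl

jCount kCount : ℕ → ℕ → ℕ
jCount zero    = isZero
jCount (suc m) = geometric (suc m) (kCount m)
kCount m       = geometric (2* m +1) (jCount m)

Fin-jCount↔ : ∀ m N → Fin (jCount m N) ↔ JBounded m N
Fin-kCount↔ : ∀ m N → Fin (kCount m N) ↔ KBounded m N
Fin-jCount↔ zero    = Fin-isZero↔JBounded0
Fin-jCount↔ (suc m) = Fin-geometric↔ (suc m) (kCount m) (KBounded m) (JBounded (suc m)) (s≤s z≤n) (Fin-kCount↔ m) (JBounded-split m)
Fin-kCount↔ m       = Fin-geometric↔ (2* m +1) (jCount m) (JBounded m) (KBounded m) (s≤s z≤n) (Fin-jCount↔ m) (KBounded-split m)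

Partition01↔JBounded : ∀ M N → N ≤ M → Partition01 N ↔ JBounded M N
Partition01↔JBounded M N N≤M = mk↔ₛ′ to from (λ { (xs , p) → Bounded-≡ xs _ p }) (λ _ → refl)
  where
  to : Partition01 N → JBounded M N
  to (xs , j , e) = xs , j , e , ℕ.≤-trans (subst (first xs ≤_) e (first≤sum xs)) N≤M
                              , ℕ.≤-trans (subst (second xs ≤_) e (second≤sum xs)) N≤M
  from : JBounded M N → Partition01 N
  from (xs , j , e , _ , _) = xs , j , e

jCount-inverse : ∀ v → ∏1-q^ jaggedExponents v · (λ N → + jCount v N) ≈ 1ₛ
jCount-inverse = ∏jaggedExponents-inverse (λ v N → + jCount v N) (λ v N → + kCount v N)
  (mk≈ λ { zero → refl ; (suc N) → refl })
  (λ v → 1-q^-geometric (suc v) (kCount v) (s≤s z≤n))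
  (λ v → 1-q^-geometric (2* v +1) (jCount v) (s≤s z≤n))


divides-abs : ∀ {k : ℕ} {x z : ℤ} → x ≡ + k * z → k ∣ ∣ x ∣
divides-abs {k} {x} {z} x≡kz = divides ∣ z ∣ (trans (cong ∣_∣ x≡kz) (trans (ℤ.abs-* (+ k) z) (ℕ.*-comm k ∣ z ∣)))

corollary10 : (n : ℕ) →
    Σ ℕ (λ k → (Fin k ↔ Partition01 (8 *ℕ n +ℕ 7)) × (64 ∣ k))
corollary10 n = jCount (N +ℕ N) N , Fin↔Partition01 , divides-abs (proj₂ coefficient≡64z)
  where
  open Residue7Mod8 n using (N; 64∣coefficient)
  Fin↔Partition01 : Fin (jCount (N +ℕ N) N) ↔ Partition01 N
  Fin↔Partition01 = ↔-trans (Fin-jCount↔ (N +ℕ N) N) (↔-sym (Partition01↔JBounded (N +ℕ N) N (ℕ.m≤m+n N N)))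
  c : Series
  c M = + jCount (N +ℕ N) M
  coefficient≡64z : Σ ℤ (λ z → c N ≡ + 64 * z)
  coefficient≡64z = 64∣coefficient (2* N +1) c (θ·-inverse N c (jCount-inverse (N +ℕ N))) (s≤s (ℕ.m≤m+n N N))
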